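{- In the setting described, for every $1\le d\le d_0$ the map $\widehat{\mathcal H_{<d}}:\mathcal R\to\mathbb K$ is an $\mathbb F_p$-algebra homomorphism from $(\mathcal R,\ast)$; that is, $\widehat{\mathcal H_{<d}}(x_{\mathbf r}\ast x_{\mathbf s})=\mathcal H_{<d}(\mathbf r)\mathcal H_{<d}(\mathbf s)$ for all indices $\mathbf r,\mathbf s\in\mathbf I$.
   Context: Let $r$ be a power of a prime $p$, $A=\mathbb F_r[\theta]$, $A_{<d}$ the polynomials of degree $<d$ (including $0$). Let $\mathbb K$ be an integral domain containing $\mathbb F_r$, $d_0\in\mathbb N$, and suppose each $a\in A_{<d_0}$ is assigned $[a]\in\mathbb K$ with: $[a]\in\mathbb K^\times$ for monic $a$ of degree $<d_0$; $[a+b]=[a]+[b]$; $[\varepsilon a]=\varepsilon[a]$ for $\varepsilon\in\mathbb F_r$. $\mathbf I$ is the set of finite tuples of positive integers including $\varnothing$. For non-empty $\mathbf s=(s_1,\dots,s_m)\in\mathbf I$ and $1\le d\le d_0$, $\mathcal H_{<d}(\mathbf s)=\sum[a_1]^{ -s_1}\cdots[a_m]^{ -s_m}$ over monic $a_1,\dots,a_m$ with $d>\deg a_1>\cdots>\deg a_m\ge0$; $\mathcal H_{<d}(\varnothing)=1$. The $r$-shuffle algebra: $\mathcal R$ is the $\mathbb F_p$-vector space with basis the free monoid on $x_k$ ($k\in\mathbb N$); $x_{\mathbf s}=x_{s_1}\cdots x_{s_m}$, $x_\varnothing=1$, $\mathbf s^-=(s_2,\dots,s_m)$; for $r_1,s_1\in\mathbb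 N$ and positive $i,j$, $\Delta^{i,j}_{r_1,s_1}=(-1)^{r_1-1}\binom{j-1}{r_1-1}+(-1)^{s_1-1}\binom{j-1}{s_1-1}$ if $(r-1)\mid j$, else $0$ (binomials mod $p$). The product $\ast$ is $\mathbb F_p$-bilinear, defined by induction on total depth: $1\ast x_{\mathbf s}=x_{\mathbf s}\ast1=x_{\mathbf s}$ and for non-empty $\mathbf r,\mathbf s$: $x_{\mathbf r}\ast x_{\mathbf s}=x_{r_1}(x_{\mathbf r^- }\ast x_{\mathbf s})+x_{s_1}(x_{\mathbf r}\ast x_{\mathbf s^- })+x_{r_1+s_1}(x_{\mathbf r^- }\ast x_{\mathbf s^- })+\sum_{i+j=r_1+s_1}\Delta^{i,j}_{r_1,s_1}x_i((x_{\mathbf r^- }\ast x_{\mathbf s^- })\ast x_j)$, juxtaposition meaning concatenation extended linearly. $\widehat{\mathcal H_{<d}}:\mathcal R\to\mathbb K$ is the $\mathbb F_p$-linear map $1\mapsto1$, $x_{\mathbf s}\mapsto\mathcal H_{<d}(\mathbf s)$. -}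

module Defs where

open import Level using (Level; _⊔_) renaming (suc to lsuc)
open import Data.Nat as ℕ using (ℕ; zero; suc; _≤_; _∸_; _+_; _^_; _<ᵇ_)
open import Data.Nat.Divisibility using (_∣?_)
open import Data.Nat.Primality using (Prime)
open import Data.Nat.Combinatorics using (_C_)
open import Data.Integer as ℤ using (ℤ; +_; -[1+_])
open import Data.Sum using (_⊎_)
open import Data.Bool using (if_then_else_)
open import Data.Product using (Σ; ∃; _×_; _,_; proj₁)
open import Data.List as List using (List; []; _∷_; _++_; [_]; length; concatMap; upTo)
open import Data.List.Relation.Unary.Any using (Any)
open import Data.List.Relation.Unary.AllPairs using (AllPairs)
open import Data.Vec as Vec using (Vec; []; _∷_; zipWith; replicate)
open import Data.Vec.Relation.Binary.Pointwise.Inductive using (Pointwise)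
open import Data.Fin using (Fin; zero; suc; toℕ)
open import Relation.Nullary using (¬_; does)
open import Relation.Binary.PropositionalEquality using (_≡_)
open import Algebra.Bundles using (CommutativeRing)
open import Algebra.Morphism.Structures using (module RingMorphisms)

-- A word x_{s1}...x_{sm} is the list (s1 ∷ ... ∷ sm ∷ []); x_∅ = 1 is [].
-- An element of R is a finite formal linear combination of words,
-- represented as a list of (coefficient , word); coefficients are taken
-- in ℤ and are only ever read through ℤ → K (char K = p), i.e. mod p.

Word : Set
Word = List ℕ

Formal : Set
Formal = List (ℤ × Word)

single : Word → Formal
single w = [ (ℤ.1ℤ , w) ]

scale : ℤ → Formal → Formal
scale c = List.map (λ { (a , w) → (c ℤ.* a , w) })

prefix : ℕ → Formal → Formal
prefix k = List.map (λ { (a , w) → (a , k ∷ w) })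

sgn : ℕ → ℤ
sgn zero = ℤ.1ℤ
sgn (suc n) = ℤ.- sgn n

-- Δ^{i,j}_{r1,s1} (depends on r only through the test (r-1) ∣ j; i is
-- determined by i + j = r1 + s1)
Δ : (r r₁ s₁ i j : ℕ) → ℤ
Δ r r₁ s₁ i j =
  if does ((r ∸ 1) ∣? j)
  then sgn (r₁ ∸ 1) ℤ.* (+ ((j ∸ 1) C (r₁ ∸ 1)))
       ℤ.+ sgn (s₁ ∸ 1) ℤ.* (+ ((j ∸ 1) C (s₁ ∸ 1)))
  else ℤ.0ℤ

extL : (Word → Word → Formal) → Formal → Word → Formal
extL m f w = concatMap (λ { (a , u) → scale a (m u w) }) f

-- The recursive definition of ∗ with a fuel argument bounding the total
-- depth; with fuel = depth(r) + depth(s) (as used in _∗[_]_ below) the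
-- fuel never runs out, so this is exactly the paper's recursion.
star : (r : ℕ) → ℕ → Word → Word → Formal
star r n [] s = single s
star r n (a ∷ as) [] = single (a ∷ as)
star r zero (a ∷ as) (b ∷ bs) = []
star r (suc n) (a ∷ as) (b ∷ bs) =
  prefix a (star r n as (b ∷ bs))
  ++ prefix b (star r n (a ∷ as) bs)
  ++ prefix (a + b) (star r n as bs)
  ++ concatMap
       (λ i → scale (Δ r a b i (a + b ∸ i))
                (prefix i (extL (star r n) (star r n as bs) [ a + b ∸ i ])))
       (List.map suc (upTo (a + b ∸ 1)))   -- i = 1 , … , a+b-1 ; j = a+b-i

_∗[_]_ : Word → ℕ → Word → Formal
u ∗[ r ] v = star r (length u + length v) u v

record IsFiniteField {c ℓ} (F : CommutativeRing c ℓ) (q : ℕ) : Set (c ⊔ ℓ) where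
  open CommutativeRing F
  field
    1≉0      : ¬ (1# ≈ 0#)
    inverse  : ∀ x → ¬ (x ≈ 0#) → ∃ λ y → (x * y) ≈ 1#
    elems    : List Carrier
    complete : ∀ x → Any (x ≈_) elems
    distinct : AllPairs (λ x y → ¬ (x ≈ y)) elems
    card     : length elems ≡ q

record IsIntegralDomain {c ℓ} (K : CommutativeRing c ℓ) : Set (c ⊔ ℓ) where
  open CommutativeRing K
  field
    1≉0         : ¬ (1# ≈ 0#)
    noZeroDivisors : ∀ x y → (x * y) ≈ 0# → (x ≈ 0#) ⊎ (y ≈ 0#)

-- Polynomials of degree < d are coefficient vectors (c₀ , … , c_{d-1}).
-- monic d k c : the monic polynomial c₀ + c₁θ + … + c_{k-1}θ^{k-1} + θ^k
-- of degree k (< d), seen in A_{<d}.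
monic : ∀ {a} {A : Set a} (zero# one# : A) (d : ℕ) (k : Fin d) → Vec A (toℕ k) → Vec A d
monic z o (suc d) zero [] = o ∷ replicate d z
monic z o (suc d) (suc k) (x ∷ c) = x ∷ monic z o d k c

tuples : ∀ {a} {A : Set a} → List A → (k : ℕ) → List (Vec A k)
tuples xs zero = [ [] ]
tuples xs (suc k) = concatMap (λ x → List.map (x ∷_) (tuples xs k)) xs

record Setting (c₁ ℓ₁ c₂ ℓ₂ : Level) : Set (lsuc (c₁ ⊔ ℓ₁ ⊔ c₂ ⊔ ℓ₂)) where
  field
    p e r    : ℕ
    p-prime  : Prime p
    1≤e      : 1 ≤ e
    r≡p^e    : r ≡ p ^ e
    F        : CommutativeRing c₁ ℓ₁
    F-finite : IsFiniteField F r
    K        : CommutativeRing c₂ ℓ₂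
    K-domain : IsIntegralDomain K
  module F = CommutativeRing F
  module K = CommutativeRing K
  field
    ι        : F.Carrier → K.Carrier
    ι-mono   : RingMorphisms.IsRingMonomorphism F.rawRing K.rawRing ι
    d₀       : ℕ
    ⟦_⟧      : Vec F.Carrier d₀ → K.Carrier
    ⟦⟧-cong  : ∀ {a b} → Pointwise F._≈_ a b → ⟦ a ⟧ K.≈ ⟦ b ⟧
    ⟦⟧-add   : ∀ a b → ⟦ zipWith F._+_ a b ⟧ K.≈ (⟦ a ⟧ K.+ ⟦ b ⟧)
    ⟦⟧-scal  : ∀ (ε : F.Carrier) a → ⟦ Vec.map (ε F.*_) a ⟧ K.≈ (ι ε K.* ⟦ a ⟧)
    ⟦⟧-unit  : (k : Fin d₀) (c : Vec F.Carrier (toℕ k)) →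
               Σ K.Carrier (λ y → (⟦ monic F.0# F.1# d₀ k c ⟧ K.* y) K.≈ K.1#)

  inv : (k : Fin d₀) → Vec F.Carrier (toℕ k) → K.Carrier
  inv k c = proj₁ (⟦⟧-unit k c)

  sumK : List K.Carrier → K.Carrier
  sumK = List.foldr K._+_ K.0#

  powK : K.Carrier → ℕ → K.Carrier
  powK x zero = K.1#
  powK x (suc n) = x K.* powK x n

  natK : ℕ → K.Carrier
  natK zero = K.0#
  natK (suc n) = K.1# K.+ natK n

  intK : ℤ → K.Carrier
  intK (+ n) = natK n
  intK -[1+ n ] = K.- natK (suc n)

  -- ℋ_{<d}(s) = Σ_{d > deg a₁ > ⋯ > deg a_m ≥ 0, aᵢ monic} [a₁]^{-s₁}⋯[a_m]^{-s_m},
  -- written as the iterated sum over the degree k = deg a₁ < d and a₁.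
  -- (Only used for d ≤ d₀; then k ranges over all of {0,…,d-1}.)
  ℋ : ℕ → Word → K.Carrier
  ℋ d [] = K.1#
  ℋ d (s ∷ ss) =
    sumK (List.map
      (λ k → if toℕ k <ᵇ d
             then sumK (List.map (λ c → powK (inv k c) s K.* ℋ (toℕ k) ss)
                                 (tuples (IsFiniteField.elems F-finite) (toℕ k)))
             else K.0#)
      (List.allFin d₀))

  ℋ̂ : ℕ → Formal → K.Carrier
  ℋ̂ d f = sumK (List.map (λ { (a , w) → intK a K.* ℋ d w }) f)

{-# OPTIONS --safe #-}
-- Writing S_d(s) = ∑ [a]⁻ˢ over the monic a of degree d, one has
-- ℋ_{<d+1}(s, 𝐬) = ℋ_{<d}(s, 𝐬) + S_d(s) ℋ_{<d}(𝐬). Applied to the four kinds of terms in the recursion for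
-- x_𝐫 ∗ x_𝐬, this reduces the product formula at level d+1 to the one at level d together with Chen's formula
--   S_d(a) S_d(b) = S_d(a+b) + ∑_{i+j=a+b} Δ^{i,j}_{a,b} S_d(i) ℋ_{<d}(j).
-- For Chen's formula write the second monic as A - δ with deg δ < d. The term δ = 0 gives S_d(a+b). For δ = εM
-- (ε ∈ 𝔽_r^×, M monic) one has 1/[A] · 1/[A-δ] = C (1/[A-δ] - 1/[A]) with C = 1/(ε[M]), and partial fractions
-- expand [A]⁻ᵃ[A-δ]⁻ᵇ in powers of 1/[A], 1/[A-δ] and ±C. Summing over A gives S_d(i), summing over M gives ℋ_{<d}(j),
-- and summing over ε gives ∑_ε ε⁻ʲ, which is -1 if (r-1) ∣ j and 0 otherwise; this produces exactly Δ^{i,j}_{a,b}.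
module Submission where

open import Defs
open import Level using (Level; _⊔_)
open import Data.Nat as ℕ using (ℕ; zero; suc; _≤_; _<_; _∸_; z≤n; s≤s; _<ᵇ_; _≡ᵇ_)
import Data.Nat.Properties as ℕP
open import Data.Nat.Divisibility using (_∣_; divides; m%n≡0⇒n∣m)
open import Data.Nat.DivMod using (_%_; _/_; m≡m%n+[m/n]*n; m%n<n)
open import Data.Integer as ℤ using (ℤ; -[1+_])
import Data.Integer.Properties as ℤP
open import Data.Sign as Sign using (Sign)
open import Data.Fin as Fin using (Fin; toℕ)
import Data.Fin.Properties as FinP
open import Data.Maybe using (Maybe; just; nothing)
open import Data.Bool using (Bool; true; false; if_then_else_)
import Data.Bool
open import Data.Unit using (tt)
open import Data.List as List using (List; []; _∷_; _++_; length)
import Data.List.Properties as ListP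
open import Data.List.Relation.Unary.All as All using (All; []; _∷_)
import Data.List.Relation.Unary.All.Properties as AllP
open import Data.List.Relation.Unary.Any as Any using (Any; here; there)
import Data.List.Relation.Unary.Any.Properties as AnyP
open import Data.List.Relation.Unary.AllPairs using ([]; _∷_)
open import Data.Vec as Vec using (Vec; []; _∷_; _∷ʳ_; zipWith)
open import Data.Vec.Relation.Binary.Pointwise.Inductive as Pointwise using (Pointwise; []; _∷_)
open import Data.Product using (Σ; _,_; proj₁; proj₂; uncurry)
open import Data.Sum using (_⊎_; inj₁; inj₂)
open import Data.Empty using (⊥-elim)
open import Relation.Nullary using (¬_; yes; no; Dec; does)
open import Relation.Binary.Bundles using (Setoid)
open import Relation.Binary.PropositionalEquality as ≡ using (_≡_)
import Relation.Binary.Construct.On as On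
open import Function.Bundles using (Inverse)
open import Function.Definitions using (Congruent; StrictlyInverseˡ; StrictlyInverseʳ)
open import Algebra.Bundles using (CommutativeMonoid; CommutativeRing; Ring)
open import Algebra.Morphism.Structures using (module RingMorphisms)
open import Algebra.Solver.Ring.AlmostCommutativeRing using (_-Raw-AlmostCommutative⟶_; fromCommutativeRing)
import Algebra.Solver.Ring as RingSolver
import Algebra.Properties.Ring as RingProperties

induction-below : ∀ {p} n (P : ℕ → Set p) → P 0 → (∀ (k : Fin n) → P (toℕ k) → P (suc (toℕ k))) → ∀ d → d ≤ n → P d
induction-below n P P0 step zero    _   = P0
induction-below n P P0 step (suc d) d<n =
  ≡.subst (λ m → P (suc m)) toℕk≡d (step k (≡.subst P (≡.sym toℕk≡d) (induction-below n P P0 step d (ℕP.<⇒≤ d<n))))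
  where
  k : Fin n
  k = Fin.fromℕ< d<n
  toℕk≡d : toℕ k ≡ d
  toℕk≡d = FinP.toℕ-fromℕ< d<n

module Removal {a ℓ} (X : Setoid a ℓ) where
  open Setoid X renaming (Carrier to A; _≈_ to _≃_)
  open import Data.List.Membership.Setoid X using (_∈_; _─_)
  open import Data.List.Membership.Setoid.Properties using (∈-lookup)
  open import Data.List.Relation.Unary.Unique.Setoid X using (Unique)

  ∈-─⁻ : ∀ {xs z} (z∈ : z ∈ xs) {y} → y ∈ (xs ─ z∈) → y ∈ xs
  ∈-─⁻ (here _)   y∈         = there y∈
  ∈-─⁻ (there z∈) (here y≃)  = here y≃
  ∈-─⁻ (there z∈) (there y∈) = there (∈-─⁻ z∈ y∈)

  ∈-─⁺ : ∀ {xs z} (z∈ : z ∈ xs) {y} → y ∈ xs → y ≃ Any.lookup z∈ ⊎ y ∈ (xs ─ z∈)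
  ∈-─⁺ (here _)   (here y≃)  = inj₁ y≃
  ∈-─⁺ (here _)   (there y∈) = inj₂ y∈
  ∈-─⁺ (there z∈) (here y≃)  = inj₂ (here y≃)
  ∈-─⁺ (there z∈) (there y∈) with ∈-─⁺ z∈ y∈
  ... | inj₁ y≃ = inj₁ y≃
  ... | inj₂ y∈′ = inj₂ (there y∈′)

  unique-─ : ∀ {xs z} (z∈ : z ∈ xs) → Unique xs → Unique (xs ─ z∈)
  unique-─ (here _)   (_ ∷ u)   = u
  unique-─ (there z∈) (x≄ ∷ u) = AllP.─⁺ z∈ x≄ ∷ unique-─ z∈ u

  ∉-apart : ∀ {x xs} → All (λ y → ¬ x ≃ y) xs → ∀ {z} → z ∈ xs → ¬ z ≃ x
  ∉-apart (x≄ ∷ _)  (here z≃)  z≃x = x≄ (trans (sym z≃x) z≃)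
  ∉-apart (_ ∷ x≄s) (there z∈) z≃x = ∉-apart x≄s z∈ z≃x

  ─-apart : ∀ {xs z} (z∈ : z ∈ xs) → Unique xs → ∀ {y} → y ∈ (xs ─ z∈) → ¬ y ≃ Any.lookup z∈
  ─-apart (here _)   (x≄ ∷ _) y∈        = ∉-apart x≄ y∈
  ─-apart (there z∈) (x≄ ∷ _) (here y≃) y≃z =
    ∉-apart x≄ (∈-lookup X _ _) (trans (sym y≃z) y≃)
  ─-apart (there z∈) (_ ∷ u) (there y∈) = ─-apart z∈ u y∈

module MonoidSums {c ℓ} (M : CommutativeMonoid c ℓ) where
  open CommutativeMonoid M
  open import Algebra.Definitions.RawMonoid rawMonoid using (_×_)
  open import Relation.Binary.Reasoning.Setoid setoid

  ∑ : ∀ {a} {A : Set a} → List A → (A → Carrier) → Carrier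
  ∑ xs f = List.foldr _∙_ ε (List.map f xs)

  ∑-ε : ∀ {a} {A : Set a} (xs : List A) → ∑ xs (λ _ → ε) ≈ ε
  ∑-ε []       = refl
  ∑-ε (x ∷ xs) = trans (identityˡ _) (∑-ε xs)

  ∑-∙ : ∀ {a} {A : Set a} (xs : List A) (f g : A → Carrier) → ∑ xs (λ x → f x ∙ g x) ≈ ∑ xs f ∙ ∑ xs g
  ∑-∙ []       f g = sym (identityˡ ε)
  ∑-∙ (x ∷ xs) f g = begin
    (f x ∙ g x) ∙ ∑ xs (λ x → f x ∙ g x) ≈⟨ ∙-congˡ (∑-∙ xs f g) ⟩
    (f x ∙ g x) ∙ (∑ xs f ∙ ∑ xs g)      ≈⟨ interchange _ _ _ _ ⟩
    (f x ∙ ∑ xs f) ∙ (g x ∙ ∑ xs g)      ∎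
    where open import Algebra.Properties.CommutativeSemigroup commutativeSemigroup using (interchange)

  module _ {a} {A : Set a} where

    ∑-cong : ∀ xs {f g : A → Carrier} → (∀ x → f x ≈ g x) → ∑ xs f ≈ ∑ xs g
    ∑-cong []       f≈g = refl
    ∑-cong (x ∷ xs) f≈g = ∙-cong (f≈g x) (∑-cong xs f≈g)

    ∑-cong-All : ∀ {p} {P : A → Set p} {xs} {f g : A → Carrier} →
                 All P xs → (∀ {x} → P x → f x ≈ g x) → ∑ xs f ≈ ∑ xs g
    ∑-cong-All []         f≈g = refl
    ∑-cong-All (px ∷ pxs) f≈g = ∙-cong (f≈g px) (∑-cong-All pxs f≈g)

    ∑-++ : ∀ xs ys (f : A → Carrier) → ∑ (xs ++ ys) f ≈ ∑ xs f ∙ ∑ ys f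
    ∑-++ []       ys f = sym (identityˡ _)
    ∑-++ (x ∷ xs) ys f = trans (∙-congˡ (∑-++ xs ys f)) (sym (assoc _ _ _))

    ∑-swap : ∀ {b} {B : Set b} xs (ys : List B) (f : A → B → Carrier) →
             ∑ xs (λ x → ∑ ys (f x)) ≈ ∑ ys (λ y → ∑ xs (λ x → f x y))
    ∑-swap []       ys f = sym (∑-ε ys)
    ∑-swap (x ∷ xs) ys f =
      trans (∙-congˡ (∑-swap xs ys f)) (sym (∑-∙ ys (f x) (λ y → ∑ xs (λ x → f x y))))

  ∑-const : ∀ {a} {A : Set a} (xs : List A) x → ∑ xs (λ _ → x) ≡ length xs × x
  ∑-const []       x = ≡.refl
  ∑-const (_ ∷ xs) x = ≡.cong (x ∙_) (∑-const xs x)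

  ∑-map : ∀ {a b} {A : Set a} {B : Set b} xs (h : A → B) (f : B → Carrier) →
          ∑ (List.map h xs) f ≡ ∑ xs (λ x → f (h x))
  ∑-map xs h f = ≡.cong (List.foldr _∙_ ε) (≡.sym (ListP.map-∘ xs))

  ∑-concatMap : ∀ {a b} {A : Set a} {B : Set b} xs (h : A → List B) (f : B → Carrier) →
                ∑ (List.concatMap h xs) f ≈ ∑ xs (λ x → ∑ (h x) f)
  ∑-concatMap []       h f = refl
  ∑-concatMap (x ∷ xs) h f = trans (∑-++ (h x) (List.concatMap h xs) f) (∙-congˡ (∑-concatMap xs h f))

  ∑-upTo-suc : ∀ n (f : ℕ → Carrier) → ∑ (List.upTo (suc n)) f ≡ f 0 ∙ ∑ (List.upTo n) (λ i → f (suc i))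
  ∑-upTo-suc n f = ≡.trans (≡.cong (List.foldr _∙_ ε) (ListP.map-upTo f (suc n)))
                           (≡.cong (f 0 ∙_) (≡.sym (≡.cong (List.foldr _∙_ ε) (ListP.map-upTo (λ i → f (suc i)) n))))

  ∑-allFin-suc : ∀ n (f : Fin (suc n) → Carrier) → ∑ (List.allFin (suc n)) f ≡ f Fin.zero ∙ ∑ (List.allFin n) (λ k → f (Fin.suc k))
  ∑-allFin-suc n f = ≡.trans (≡.cong (List.foldr _∙_ ε) (ListP.map-tabulate (λ k → k) f))
                             (≡.cong (f Fin.zero ∙_) (≡.sym (≡.cong (List.foldr _∙_ ε) (ListP.map-tabulate (λ k → k) (λ k → f (Fin.suc k))))))

  ∑-upTo-last : ∀ n (f : ℕ → Carrier) → ∑ (List.upTo (suc n)) f ≈ ∑ (List.upTo n) f ∙ f n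
  ∑-upTo-last n f = begin
    ∑ (List.upTo (suc n)) f          ≡⟨ ≡.cong (λ xs → ∑ xs f) (ListP.upTo-∷ʳ n) ⟨
    ∑ (List.upTo n ++ List.[ n ]) f  ≈⟨ ∑-++ (List.upTo n) List.[ n ] f ⟩
    ∑ (List.upTo n) f ∙ (f n ∙ ε)    ≈⟨ ∙-congˡ (identityʳ (f n)) ⟩
    ∑ (List.upTo n) f ∙ f n          ∎

  ∑-upTo-interior : ∀ n (W f : ℕ → Carrier) → 1 ≤ n → W 0 ≈ ε → W n ≈ ε → (∀ i → 1 ≤ i → i < n → W i ≈ f i) →
                    ∑ (List.upTo (suc n)) W ≈ ∑ (List.map suc (List.upTo (n ∸ 1))) f
  ∑-upTo-interior (suc m) W f _ W0≈ε Wn≈ε W≈f = begin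
    ∑ (List.upTo (suc (suc m))) W                       ≡⟨ ∑-upTo-suc (suc m) W ⟩
    W 0 ∙ ∑ (List.upTo (suc m)) (λ i → W (suc i))       ≈⟨ ∙-cong W0≈ε (∑-upTo-last m (λ i → W (suc i))) ⟩
    ε ∙ (∑ (List.upTo m) (λ i → W (suc i)) ∙ W (suc m)) ≈⟨ trans (identityˡ _) (∙-congˡ Wn≈ε) ⟩
    ∑ (List.upTo m) (λ i → W (suc i)) ∙ ε               ≈⟨ identityʳ _ ⟩
    ∑ (List.upTo m) (λ i → W (suc i))                   ≈⟨ ∑-cong-All (AllP.applyUpTo⁺₁ (λ i → i) m (λ i<m → i<m))
                                                             (λ {i} i<m → W≈f (suc i) (s≤s z≤n) (s≤s i<m)) ⟩
    ∑ (List.upTo m) (λ i → f (suc i))                   ≡⟨ ∑-map (List.upTo m) suc f ⟨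
    ∑ (List.map suc (List.upTo m)) f                    ∎

  module Reindexing {a ℓ′} (X : Setoid a ℓ′) where
    open Setoid X using () renaming (Carrier to A; _≈_ to _≃_; refl to ≃-refl; sym to ≃-sym; trans to ≃-trans)
    open import Data.List.Membership.Setoid X using (_∈_; _─_)
    open import Data.List.Relation.Unary.Unique.Setoid X using (Unique)
    open import Data.List.Membership.Setoid.Properties using (∈-map⁺)
    open Removal X

    Respects≃ : (A → Carrier) → Set (a ⊔ ℓ′ ⊔ ℓ)
    Respects≃ f = ∀ {x y} → x ≃ y → f x ≈ f y

    ∑-─ : ∀ {xs z} (z∈ : z ∈ xs) (f : A → Carrier) → ∑ xs f ≈ f (Any.lookup z∈) ∙ ∑ (xs ─ z∈) f
    ∑-─ (here _)  f = refl
    ∑-─ (there z∈) f = trans (∙-congˡ (∑-─ z∈ f)) (x∙yz≈y∙xz _ _ _)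
      where open import Algebra.Properties.CommutativeSemigroup commutativeSemigroup using (x∙yz≈y∙xz)

    ∑-sameElements : ∀ {xs ys} (f : A → Carrier) → Respects≃ f → Unique xs → Unique ys →
                     (∀ {z} → z ∈ xs → z ∈ ys) → (∀ {z} → z ∈ ys → z ∈ xs) → ∑ xs f ≈ ∑ ys f
    ∑-sameElements {[]}     {[]}     f f-resp _ _ _ _ = refl
    ∑-sameElements {[]}     {y ∷ ys} f f-resp _ _ _ ys⊆ with ys⊆ (here ≃-refl)
    ... | ()
    ∑-sameElements {x ∷ xs} {ys} f f-resp (x≄ ∷ uxs) uys xs⊆ ys⊆ = begin
      f x ∙ ∑ xs f                     ≈⟨ ∙-cong (f-resp (AnyP.lookup-result x∈ys))
                                                 (∑-sameElements f f-resp uxs (unique-─ x∈ys uys) ⊆─ ─⊆) ⟩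
      f (Any.lookup x∈ys) ∙ ∑ (ys ─ x∈ys) f ≈⟨ sym (∑-─ x∈ys f) ⟩
      ∑ ys f                           ∎
      where
      x∈ys : x ∈ ys
      x∈ys = xs⊆ (here ≃-refl)
      ⊆─ : ∀ {z} → z ∈ xs → z ∈ (ys ─ x∈ys)
      ⊆─ z∈ with ∈-─⁺ x∈ys (xs⊆ (there z∈))
      ... | inj₁ z≃ = ⊥-elim (∉-apart x≄ z∈ (≃-trans z≃ (≃-sym (AnyP.lookup-result x∈ys))))
      ... | inj₂ z∈′ = z∈′
      ─⊆ : ∀ {z} → z ∈ (ys ─ x∈ys) → z ∈ xs
      ─⊆ z∈ with ys⊆ (∈-─⁻ x∈ys z∈)
      ... | here z≃  = ⊥-elim (─-apart x∈ys uys z∈ (≃-trans z≃ (AnyP.lookup-result x∈ys)))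
      ... | there z∈′ = z∈′

    ∑-reindex : ∀ {xs} → (∀ x → x ∈ xs) → Unique xs → (σ : Inverse X X) (f : A → Carrier) → Respects≃ f →
                ∑ xs (λ x → f (Inverse.to σ x)) ≈ ∑ xs f
    ∑-reindex {xs} complete unique σ f f-resp = begin
      ∑ xs (λ x → f (to x)) ≡⟨ ∑-map xs to f ⟨
      ∑ (List.map to xs) f  ≈⟨ ∑-sameElements f f-resp (UniqueP.map⁺ X X to-injective unique) unique
                                 (λ _ → complete _) (λ {z} _ → hit z) ⟩
      ∑ xs f                ∎
      where
      open Inverse σ
      import Data.List.Relation.Unary.Unique.Setoid.Properties as UniqueP
      to-injective : ∀ {x y} → to x ≃ to y → x ≃ y
      to-injective {x} {y} tx≃ty = ≃-trans (≃-sym (strictlyInverseʳ x)) (≃-trans (from-cong tx≃ty) (strictlyInverseʳ y))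
      hit : ∀ z → z ∈ List.map to xs
      hit z = Any.map (≃-trans (≃-sym (strictlyInverseˡ z))) (∈-map⁺ X X to-cong (complete (from z)))

module RingSums {c ℓ} (R : CommutativeRing c ℓ) where
  open CommutativeRing R hiding (zero)
  open import Relation.Binary.Reasoning.Setoid setoid
  open MonoidSums +-commutativeMonoid public renaming (∑-ε to ∑-0; ∑-∙ to ∑-+)
  open RingProperties ring using (-0#≈0#; -‿+-comm)

  module _ {a} {A : Set a} where

    ∑-*ˡ : ∀ xs x (f : A → Carrier) → ∑ xs (λ y → x * f y) ≈ x * ∑ xs f
    ∑-*ˡ []       x f = sym (zeroʳ x)
    ∑-*ˡ (y ∷ xs) x f = trans (+-congˡ (∑-*ˡ xs x f)) (sym (distribˡ x _ _))

    ∑-*ʳ : ∀ xs x (f : A → Carrier) → ∑ xs (λ y → f y * x) ≈ ∑ xs f * x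
    ∑-*ʳ xs x f = trans (∑-cong xs (λ y → *-comm (f y) x)) (trans (∑-*ˡ xs x f) (*-comm x _))

    ∑-neg : ∀ xs (f : A → Carrier) → ∑ xs (λ y → - f y) ≈ - ∑ xs f
    ∑-neg []       f = sym -0#≈0#
    ∑-neg (y ∷ xs) f = trans (+-congˡ (∑-neg xs f)) (-‿+-comm _ _)

    ∑-if : ∀ xs (b : Bool) (f : A → Carrier) → ∑ xs (λ y → if b then f y else 0#) ≈ (if b then ∑ xs f else 0#)
    ∑-if xs true  f = refl
    ∑-if xs false f = ∑-0 xs

  ∑-allFin-below-suc : ∀ {n} (j : Fin n) (f : Fin n → Carrier) →
    ∑ (List.allFin n) (λ k → if toℕ k <ᵇ suc (toℕ j) then f k else 0#) ≈
    ∑ (List.allFin n) (λ k → if toℕ k <ᵇ toℕ j then f k else 0#) + f j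
  ∑-allFin-below-suc {n} j f = begin
    ∑ (List.allFin n) (λ k → if toℕ k <ᵇ suc (toℕ j) then f k else 0#)
      ≈⟨ ∑-cong (List.allFin n) (λ k → split (toℕ k) (toℕ j) (f k)) ⟩
    ∑ (List.allFin n) (λ k → (if toℕ k <ᵇ toℕ j then f k else 0#) + (if toℕ k ≡ᵇ toℕ j then f k else 0#))
      ≈⟨ ∑-+ (List.allFin n) _ _ ⟩
    ∑ (List.allFin n) (λ k → if toℕ k <ᵇ toℕ j then f k else 0#) + ∑ (List.allFin n) (λ k → if toℕ k ≡ᵇ toℕ j then f k else 0#)
      ≈⟨ +-congˡ (pick j f) ⟩
    ∑ (List.allFin n) (λ k → if toℕ k <ᵇ toℕ j then f k else 0#) + f j ∎
    where
    split : ∀ m d x → (if m <ᵇ suc d then x else 0#) ≈ (if m <ᵇ d then x else 0#) + (if m ≡ᵇ d then x else 0#)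
    split zero    zero    x = sym (+-identityˡ x)
    split zero    (suc d) x = sym (+-identityʳ x)
    split (suc m) zero    x = sym (+-identityˡ _)
    split (suc m) (suc d) x = split m d x
    pick : ∀ {n} (j : Fin n) (f : Fin n → Carrier) → ∑ (List.allFin n) (λ k → if toℕ k ≡ᵇ toℕ j then f k else 0#) ≈ f j
    pick {suc n} Fin.zero    f = begin
      ∑ (List.allFin (suc n)) _                  ≡⟨ ∑-allFin-suc n _ ⟩
      f Fin.zero + ∑ (List.allFin n) (λ _ → 0#)  ≈⟨ +-congˡ (∑-0 (List.allFin n)) ⟩
      f Fin.zero + 0#                            ≈⟨ +-identityʳ _ ⟩
      f Fin.zero                                 ∎
    pick {suc n} (Fin.suc j) f = begin
      ∑ (List.allFin (suc n)) _              ≡⟨ ∑-allFin-suc n _ ⟩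
      0# + ∑ (List.allFin n) (λ k → if toℕ k ≡ᵇ toℕ j then f (Fin.suc k) else 0#) ≈⟨ +-identityˡ _ ⟩
      _                                      ≈⟨ pick j (λ k → f (Fin.suc k)) ⟩
      f (Fin.suc j)                          ∎

module IntegerImage {c ℓ} (R : CommutativeRing c ℓ) where
  open import Data.Integer using (+_)
  open CommutativeRing R hiding (zero)
  open import Relation.Binary.Reasoning.Setoid setoid
  open import Algebra.Definitions.RawMonoid +-rawMonoid using (_×_)
  open import Algebra.Properties.Semiring.Mult semiring using (×-homo-+; ×1-homo-*)
  open RingProperties ring using (-0#≈0#; -‿involutive; -‿+-comm; -‿distribˡ-*)

  fromℕ : ℕ → Carrier
  fromℕ n = n × 1#

  fromℤ : ℤ → Carrier
  fromℤ (+ n)     = fromℕ n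
  fromℤ -[1+ n ] = - fromℕ (suc n)

  private
    fromℤ-⊖ : ∀ m n → fromℤ (m ℤ.⊖ n) ≈ fromℕ m - fromℕ n
    fromℤ-⊖ zero    zero    = sym (-‿inverseʳ 0#)
    fromℤ-⊖ (suc m) zero    = sym (trans (+-congˡ -0#≈0#) (+-identityʳ _))
    fromℤ-⊖ zero    (suc n) = sym (+-identityˡ _)
    fromℤ-⊖ (suc m) (suc n) = begin
      fromℤ (suc m ℤ.⊖ suc n)         ≡⟨ ≡.cong fromℤ (ℤP.[1+m]⊖[1+n]≡m⊖n m n) ⟩
      fromℤ (m ℤ.⊖ n)                 ≈⟨ fromℤ-⊖ m n ⟩
      x - y                           ≈⟨ +-identityˡ _ ⟨
      0# + (x - y)                    ≈⟨ +-congʳ (-‿inverseʳ 1#) ⟨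
      (1# - 1#) + (x - y)             ≈⟨ interchange 1# (- 1#) x (- y) ⟩
      (1# + x) + (- 1# - y)           ≈⟨ +-congˡ (-‿+-comm 1# y) ⟩
      (1# + x) - (1# + y)             ∎
      where
      x y : Carrier
      x = fromℕ m
      y = fromℕ n
      open import Algebra.Properties.CommutativeSemigroup +-commutativeSemigroup using (interchange)

  fromℤ-+ : ∀ x y → fromℤ (x ℤ.+ y) ≈ fromℤ x + fromℤ y
  fromℤ-+ -[1+ m ] -[1+ n ] = begin
    - fromℕ (suc (suc (m ℕ.+ n)))            ≈⟨ -‿cong (+-congˡ (×-homo-+ 1# (suc m) n)) ⟩
    - (1# + (fromℕ (suc m) + fromℕ n))       ≈⟨ -‿cong (x∙yz≈y∙xz 1# _ _) ⟩
    - (fromℕ (suc m) + fromℕ (suc n))        ≈⟨ -‿+-comm _ _ ⟨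
    - fromℕ (suc m) - fromℕ (suc n)          ∎
    where open import Algebra.Properties.CommutativeSemigroup +-commutativeSemigroup using (x∙yz≈y∙xz)
  fromℤ-+ -[1+ m ] (+ n)    = trans (fromℤ-⊖ n (suc m)) (+-comm _ _)
  fromℤ-+ (+ m)    -[1+ n ] = fromℤ-⊖ m (suc n)
  fromℤ-+ (+ m)    (+ n)    = ×-homo-+ 1# m n

  fromℤ-neg : ∀ x → fromℤ (ℤ.- x) ≈ - fromℤ x
  fromℤ-neg (+ zero)  = sym -0#≈0#
  fromℤ-neg (+ suc n) = refl
  fromℤ-neg -[1+ n ]  = sym (-‿involutive _)

  fromℤ-minus : ∀ x y → fromℤ (x ℤ.- y) ≈ fromℤ x - fromℤ y
  fromℤ-minus x y = trans (fromℤ-+ x (ℤ.- y)) (+-congˡ (fromℤ-neg y))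

  private
    fromSign : Sign → Carrier
    fromSign Sign.+ = 1#
    fromSign Sign.- = - 1#

    fromSign-* : ∀ s t → fromSign (s Sign.* t) ≈ fromSign s * fromSign t
    fromSign-* Sign.- Sign.- = sym (trans (sym (-‿distribˡ-* 1# (- 1#))) (trans (-‿cong (*-identityˡ _)) (-‿involutive 1#)))
    fromSign-* Sign.- Sign.+ = sym (*-identityʳ _)
    fromSign-* Sign.+ Sign.- = sym (*-identityˡ _)
    fromSign-* Sign.+ Sign.+ = sym (*-identityˡ _)

    fromℤ-◃ : ∀ s n → fromℤ (s ℤ.◃ n) ≈ fromSign s * fromℕ n
    fromℤ-◃ s        zero    = sym (zeroʳ _)
    fromℤ-◃ Sign.+ (suc n) = sym (*-identityˡ _)
    fromℤ-◃ Sign.- (suc n) = sym (trans (sym (-‿distribˡ-* 1# _)) (-‿cong (*-identityˡ _)))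

    fromℤ-sign : ∀ x → fromℤ x ≈ fromSign (ℤ.sign x) * fromℕ ℤ.∣ x ∣
    fromℤ-sign x = trans (reflexive (≡.cong fromℤ (≡.sym (ℤP.◃-inverse x)))) (fromℤ-◃ (ℤ.sign x) ℤ.∣ x ∣)

  fromℤ-* : ∀ x y → fromℤ (x ℤ.* y) ≈ fromℤ x * fromℤ y
  fromℤ-* x y = begin
    fromℤ (x ℤ.* y)                                        ≈⟨ fromℤ-◃ (ℤ.sign x Sign.* ℤ.sign y) (ℤ.∣ x ∣ ℕ.* ℤ.∣ y ∣) ⟩
    fromSign (ℤ.sign x Sign.* ℤ.sign y) * fromℕ (ℤ.∣ x ∣ ℕ.* ℤ.∣ y ∣)
      ≈⟨ *-cong (fromSign-* (ℤ.sign x) (ℤ.sign y)) (×1-homo-* ℤ.∣ x ∣ ℤ.∣ y ∣) ⟩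
    (fromSign (ℤ.sign x) * fromSign (ℤ.sign y)) * (fromℕ ℤ.∣ x ∣ * fromℕ ℤ.∣ y ∣) ≈⟨ interchange _ _ _ _ ⟩
    (fromSign (ℤ.sign x) * fromℕ ℤ.∣ x ∣) * (fromSign (ℤ.sign y) * fromℕ ℤ.∣ y ∣) ≈⟨ *-cong (fromℤ-sign x) (fromℤ-sign y) ⟨
    fromℤ x * fromℤ y                                      ∎
    where open import Algebra.Properties.CommutativeSemigroup *-commutativeSemigroup using (interchange)

  fromℤ-homomorphism : Ring.rawRing ℤP.+-*-ring -Raw-AlmostCommutative⟶ fromCommutativeRing R
  fromℤ-homomorphism = record
    { ⟦_⟧ = fromℤ ; +-homo = fromℤ-+ ; *-homo = fromℤ-* ; -‿homo = fromℤ-neg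
    ; 0-homo = refl ; 1-homo = +-identityʳ 1# }

  private
    _≟-image_ : ∀ x y → Maybe (fromℤ x ≈ fromℤ y)
    x ≟-image y with x ℤ.≟ y
    ... | yes ≡.refl = just refl
    ... | no _       = nothing

  module Solver = RingSolver _ _ fromℤ-homomorphism _≟-image_

module PolynomialRoots {c ℓ} (K : CommutativeRing c ℓ) (K-domain : IsIntegralDomain K) where
  open import Data.Integer using (+_)
  open CommutativeRing K
  open IsIntegralDomain K-domain
  open import Relation.Binary.Reasoning.Setoid setoid
  open import Algebra.Properties.CommutativeSemiring.Exp commutativeSemiring using (_^_)
  open import Data.List.Relation.Unary.Unique.Setoid setoid using (Unique)
  open IntegerImage K using (module Solver)

  eval : List Carrier → Carrier → Carrier
  eval []      x = 0#
  eval (a ∷ f) x = a + x * eval f x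

  quotient : Carrier → List Carrier → List Carrier
  quotient x₀ []            = []
  quotient x₀ (a ∷ [])      = []
  quotient x₀ (a ∷ f@(_ ∷ _)) = eval f x₀ ∷ quotient x₀ f

  length-quotient : ∀ x₀ f → length (quotient x₀ f) ≡ ℕ.pred (length f)
  length-quotient x₀ []            = ≡.refl
  length-quotient x₀ (a ∷ [])      = ≡.refl
  length-quotient x₀ (a ∷ f@(_ ∷ _)) = ≡.cong suc (length-quotient x₀ f)

  eval-quotient : ∀ f x x₀ → eval f x ≈ eval f x₀ + (x - x₀) * eval (quotient x₀ f) x
  eval-quotient []            x x₀ = solve 2 (λ x x₀ → con (+ 0) := con (+ 0) :+ (x :- x₀) :* con (+ 0)) refl x x₀
    where open Solver
  eval-quotient (a ∷ [])      x x₀ =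
    solve 3 (λ a x x₀ → a :+ x :* con (+ 0) := (a :+ x₀ :* con (+ 0)) :+ (x :- x₀) :* con (+ 0)) refl a x x₀
    where open Solver
  eval-quotient (a ∷ f@(_ ∷ _)) x x₀ = begin
    a + x * eval f x                                              ≈⟨ +-congˡ (*-congˡ (eval-quotient f x x₀)) ⟩
    a + x * (eval f x₀ + (x - x₀) * eval (quotient x₀ f) x)
      ≈⟨ solve 5 (λ a x x₀ e q → a :+ x :* (e :+ (x :- x₀) :* q) := (a :+ x₀ :* e) :+ (x :- x₀) :* (e :+ x :* q))
               refl a x x₀ (eval f x₀) (eval (quotient x₀ f) x) ⟩
    (a + x₀ * eval f x₀) + (x - x₀) * (eval f x₀ + x * eval (quotient x₀ f) x) ∎
    where open Solver

  private
    zero-from-quotient : ∀ x₀ f → eval f x₀ ≈ 0# → All (_≈ 0#) (quotient x₀ f) → All (_≈ 0#) f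
    zero-from-quotient x₀ []            _ _ = []
    zero-from-quotient x₀ (a ∷ [])      f₀≈0 _ =
      trans (sym (trans (+-congˡ (zeroʳ x₀)) (+-identityʳ a))) f₀≈0 ∷ []
    zero-from-quotient x₀ (a ∷ f@(_ ∷ _)) f₀≈0 (e≈0 ∷ q≈0) =
      trans (sym (trans (+-congˡ (trans (*-congˡ e≈0) (zeroʳ x₀))) (+-identityʳ a))) f₀≈0
        ∷ zero-from-quotient x₀ f e≈0 q≈0

  distinctRoots⇒zero : ∀ f xs → Unique xs → All (λ x → eval f x ≈ 0#) xs → length f ≤ length xs → All (_≈ 0#) f
  distinctRoots⇒zero []      xs        _          _            _   = []
  distinctRoots⇒zero (_ ∷ _) []        _          _            ()
  distinctRoots⇒zero f       (x₀ ∷ xs) (x₀≉ ∷ u) (f₀≈0 ∷ fxs≈0) len =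
    zero-from-quotient x₀ f f₀≈0
      (distinctRoots⇒zero (quotient x₀ f) xs u (All.zipWith (uncurry quotient-root) (x₀≉ , fxs≈0))
        (ℕP.≤-trans (ℕP.≤-reflexive (length-quotient x₀ f)) (pred-≤ f len)))
    where
    pred-≤ : ∀ g → length g ≤ suc (length xs) → ℕ.pred (length g) ≤ length xs
    pred-≤ []      _         = z≤n
    pred-≤ (_ ∷ _) (s≤s g≤) = g≤
    quotient-root : ∀ {x} → ¬ x₀ ≈ x → eval f x ≈ 0# → eval (quotient x₀ f) x ≈ 0#
    quotient-root {x} x₀≉x fx≈0 with noZeroDivisors (x - x₀) (eval (quotient x₀ f) x) product≈0
      where
      product≈0 : (x - x₀) * eval (quotient x₀ f) x ≈ 0#
      product≈0 = begin
        (x - x₀) * eval (quotient x₀ f) x              ≈⟨ +-identityˡ _ ⟨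
        0# + (x - x₀) * eval (quotient x₀ f) x         ≈⟨ +-congʳ f₀≈0 ⟨
        eval f x₀ + (x - x₀) * eval (quotient x₀ f) x  ≈⟨ eval-quotient f x x₀ ⟨
        eval f x                                       ≈⟨ fx≈0 ⟩
        0#                                             ∎
    ... | inj₁ x-x₀≈0 = ⊥-elim (x₀≉x (sym (trans (solve 2 (λ x x₀ → x := (x :- x₀) :+ x₀) refl x x₀)
                                                (trans (+-congʳ x-x₀≈0) (+-identityˡ x₀)))))
      where open Solver
    ... | inj₂ q≈0 = q≈0

  private
    monomial : ℕ → List Carrier
    monomial zero    = 1# ∷ []
    monomial (suc n) = 0# ∷ monomial n

    eval-monomial : ∀ n x → eval (monomial n) x ≈ x ^ n
    eval-monomial zero    x = trans (+-congˡ (zeroʳ x)) (+-identityʳ 1#)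
    eval-monomial (suc n) x = trans (+-identityˡ _) (*-congˡ (eval-monomial n x))

    length-monomial : ∀ n → length (monomial n) ≡ suc n
    length-monomial zero    = ≡.refl
    length-monomial (suc n) = ≡.cong suc (length-monomial n)

    monomial≉0 : ∀ n → ¬ All (_≈ 0#) (monomial n)
    monomial≉0 zero    (1≈0 ∷ []) = 1≉0 1≈0
    monomial≉0 (suc n) (_ ∷ m≈0)  = monomial≉0 n m≈0

  rootsOfUnity-length : ∀ n {xs} → Unique xs → All (λ x → x ^ suc n ≈ 1#) xs → length xs ≤ suc n
  rootsOfUnity-length n {xs} u roots = ℕP.≮⇒≥ too-many
    where
    xⁿ⁺¹-1 : List Carrier
    xⁿ⁺¹-1 = - 1# ∷ monomial n
    root : ∀ {x} → x ^ suc n ≈ 1# → eval xⁿ⁺¹-1 x ≈ 0#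
    root {x} xⁿ⁺¹≈1 = begin
      - 1# + x * eval (monomial n) x ≈⟨ +-congˡ (*-congˡ (eval-monomial n x)) ⟩
      - 1# + x ^ suc n               ≈⟨ +-congˡ xⁿ⁺¹≈1 ⟩
      - 1# + 1#                      ≈⟨ -‿inverseˡ 1# ⟩
      0#                             ∎
    too-many : ¬ suc n < length xs
    too-many n<|xs| with distinctRoots⇒zero xⁿ⁺¹-1 xs u (All.map root roots)
                           (ℕP.≤-trans (ℕP.≤-reflexive (≡.cong suc (length-monomial n))) n<|xs|)
    ... | _ ∷ m≈0 = monomial≉0 n m≈0

module PartialFractionCoefficients where
  open import Data.Integer using (+_)
  open import Data.Nat.Combinatorics using (_C_; nCn≡1; k>n⇒nCk≡0; nCk+nC[k+1]≡[n+1]C[k+1])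
  open import Data.Integer.Solver using (module +-*-Solver)
  open import Relation.Nullary.Decidable using (does; dec-true; dec-false)

  -- If A B = C (B - A) then A^(a+1) B^(b+1) = C A^a B^(b+1) - C A^(a+1) B^b, so that
  -- A^a B^b = ∑ᵢ pf a b i · A^i C^(a+b-i) + pf b a i · B^i (-C)^(a+b-i).
  pf : ℕ → ℕ → ℕ → ℤ
  pf a       zero    i = if does (a ℕ.≟ i) then ℤ.1ℤ else ℤ.0ℤ
  pf zero    (suc b) i = ℤ.0ℤ
  pf (suc a) (suc b) i = pf a (suc b) i ℤ.- pf (suc a) b i

  pf-vanishes : ∀ a b i → a < i → pf a b i ≡ ℤ.0ℤ
  pf-vanishes a       zero    i a<i rewrite dec-false (a ℕ.≟ i) (ℕP.<⇒≢ a<i) = ≡.refl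
  pf-vanishes zero    (suc b) i _   = ≡.refl
  pf-vanishes (suc a) (suc b) i a<i
    rewrite pf-vanishes a (suc b) i (ℕP.<-trans (ℕP.n<1+n a) a<i) | pf-vanishes (suc a) b i a<i = ≡.refl

  pf-at-0 : ∀ a b → 1 ≤ a ℕ.+ b → pf a b 0 ≡ ℤ.0ℤ
  pf-at-0 (suc a) zero    _ = ≡.refl
  pf-at-0 zero    (suc b) _ = ≡.refl
  pf-at-0 (suc a) (suc b) _
    rewrite pf-at-0 a (suc b) (ℕP.≤-trans (s≤s z≤n) (ℕP.≤-reflexive (≡.sym (ℕP.+-suc a b))))
          | pf-at-0 (suc a) b (s≤s z≤n) = ≡.refl

  pf-closedForm : ∀ i t y → pf (t ℕ.+ suc i) (suc y) (suc i) ≡ sgn (suc y) ℤ.* + ((t ℕ.+ y) C y)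
  pf-closedForm i zero zero
    rewrite pf-vanishes i 1 (suc i) (ℕP.n<1+n i) | dec-true (i ℕ.≟ i) ≡.refl = ≡.refl
  pf-closedForm i zero (suc y)
    rewrite pf-vanishes i (suc (suc y)) (suc i) (ℕP.n<1+n i) | pf-closedForm i zero y | nCn≡1 y | nCn≡1 (suc y) =
    solve 1 (λ s → con ℤ.0ℤ :- s :* con (+ 1) := (:- s) :* con (+ 1)) ≡.refl (sgn (suc y))
    where open +-*-Solver
  pf-closedForm i (suc t) zero
    rewrite pf-closedForm i t zero | dec-false (t ℕ.+ suc i ℕ.≟ i) (ℕP.>⇒≢ (ℕP.m≤n+m (suc i) t)) = ≡.refl
  pf-closedForm i (suc t) (suc y) rewrite pf-closedForm i t (suc y) | pf-closedForm i (suc t) y = begin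
    sgn (suc (suc y)) ℤ.* + ((t ℕ.+ suc y) C suc y) ℤ.- sgn (suc y) ℤ.* + ((suc t ℕ.+ y) C y)
      ≡⟨ ≡.cong (λ m → sgn (suc (suc y)) ℤ.* + ((t ℕ.+ suc y) C suc y) ℤ.- sgn (suc y) ℤ.* + (m C y)) (≡.sym (ℕP.+-suc t y)) ⟩
    (ℤ.- s) ℤ.* + Y ℤ.- s ℤ.* + X ≡⟨ solve 3 (λ s x y → (:- s) :* y :- s :* x := (:- s) :* (x :+ y)) ≡.refl s (+ X) (+ Y) ⟩
    (ℤ.- s) ℤ.* (+ X ℤ.+ + Y)     ≡⟨ ≡.cong (λ m → (ℤ.- s) ℤ.* + m) (nCk+nC[k+1]≡[n+1]C[k+1] (t ℕ.+ suc y) y) ⟩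
    sgn (suc (suc y)) ℤ.* + ((suc t ℕ.+ suc y) C suc y) ∎
    where
    open +-*-Solver
    open ≡.≡-Reasoning
    s = sgn (suc y)
    X = (t ℕ.+ suc y) C y
    Y = (t ℕ.+ suc y) C suc y

  private
    top-index-small : ∀ a y i → a ≤ i → suc i < a ℕ.+ suc y → a ℕ.+ suc y ∸ suc i ∸ 1 < y
    top-index-small a y i a≤i i<a+b = begin-strict
      a ℕ.+ suc y ∸ suc i ∸ 1 ≡⟨ ≡.cong (λ m → m ∸ suc i ∸ 1) (ℕP.+-suc a y) ⟩
      a ℕ.+ y ∸ i ∸ 1         <⟨ ℕP.∸-monoʳ-< {o = 0} (s≤s z≤n) (ℕP.m<n⇒0<n∸m (ℕP.≤-pred (ℕP.≤-trans i<a+b (ℕP.≤-reflexive (ℕP.+-suc a y))))) ⟩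
      a ℕ.+ y ∸ i             ≤⟨ ℕP.∸-monoˡ-≤ i (ℕP.+-monoˡ-≤ y a≤i) ⟩
      i ℕ.+ y ∸ i             ≡⟨ ℕP.m+n∸m≡n i y ⟩
      y                       ∎
      where open ℕP.≤-Reasoning

  pf-binomial : ∀ a b i → 1 ≤ b → 1 ≤ i → i < a ℕ.+ b →
                pf a b i ≡ ℤ.- (sgn (b ∸ 1) ℤ.* + ((a ℕ.+ b ∸ i ∸ 1) C (b ∸ 1)))
  pf-binomial a (suc y) (suc i) _ _ i<a+b with suc i ℕP.≤? a
  ... | yes i≤a = begin
    pf a (suc y) (suc i)                              ≡⟨ ≡.cong (λ m → pf m (suc y) (suc i)) (ℕP.m∸n+n≡m i≤a) ⟨
    pf (t ℕ.+ suc i) (suc y) (suc i)                  ≡⟨ pf-closedForm i t y ⟩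
    sgn (suc y) ℤ.* + ((t ℕ.+ y) C y)                 ≡⟨ ℤP.neg-distribˡ-* (sgn y) (+ ((t ℕ.+ y) C y)) ⟨
    ℤ.- (sgn y ℤ.* + ((t ℕ.+ y) C y))                 ≡⟨ ≡.cong (λ m → ℤ.- (sgn y ℤ.* + (m C y))) j≡t+y ⟨
    ℤ.- (sgn y ℤ.* + ((a ℕ.+ suc y ∸ suc i ∸ 1) C y)) ∎
    where
    open ≡.≡-Reasoning
    t = a ∸ suc i
    j≡t+y : a ℕ.+ suc y ∸ suc i ∸ 1 ≡ t ℕ.+ y
    j≡t+y = ≡.trans (≡.cong (_∸ 1) (ℕP.+-∸-comm (suc y) i≤a)) (ℕP.+-∸-assoc t (s≤s z≤n))
  ... | no i≰a = begin
    pf a (suc y) (suc i)                              ≡⟨ pf-vanishes a (suc y) (suc i) (ℕP.≰⇒> i≰a) ⟩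
    ℤ.0ℤ                                              ≡⟨ ≡.cong ℤ.-_ (ℤP.*-zeroʳ (sgn y)) ⟨
    ℤ.- (sgn y ℤ.* + 0)                               ≡⟨ ≡.cong (λ m → ℤ.- (sgn y ℤ.* + m)) (k>n⇒nCk≡0 j<y) ⟨
    ℤ.- (sgn y ℤ.* + ((a ℕ.+ suc y ∸ suc i ∸ 1) C y)) ∎
    where
    open ≡.≡-Reasoning
    j<y : a ℕ.+ suc y ∸ suc i ∸ 1 < y
    j<y = top-index-small a y i (ℕP.≤-pred (ℕP.≰⇒> i≰a)) i<a+b

  pf-symmetricSum : ∀ a b i → 1 ≤ a → 1 ≤ b → 1 ≤ i → i < a ℕ.+ b →
    pf a b i ℤ.+ pf b a i ≡ ℤ.- (sgn (a ∸ 1) ℤ.* + ((a ℕ.+ b ∸ i ∸ 1) C (a ∸ 1)) ℤ.+ sgn (b ∸ 1) ℤ.* + ((a ℕ.+ b ∸ i ∸ 1) C (b ∸ 1)))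
  pf-symmetricSum a b i 1≤a 1≤b 1≤i i<a+b
    rewrite pf-binomial a b i 1≤b 1≤i i<a+b
          | pf-binomial b a i 1≤a 1≤i (ℕP.≤-trans i<a+b (ℕP.≤-reflexive (ℕP.+-comm a b)))
          | ℕP.+-comm b a =
    solve 2 (λ x y → :- y :+ :- x := :- (x :+ y)) ≡.refl
      (sgn (a ∸ 1) ℤ.* + ((a ℕ.+ b ∸ i ∸ 1) C (a ∸ 1))) (sgn (b ∸ 1) ℤ.* + ((a ℕ.+ b ∸ i ∸ 1) C (b ∸ 1)))
    where open +-*-Solver

module PartialFractions {c ℓ} (R : CommutativeRing c ℓ) where
  open CommutativeRing R hiding (zero)
  open import Relation.Binary.Reasoning.Setoid setoid
  open import Algebra.Properties.CommutativeSemiring.Exp commutativeSemiring using (_^_)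
  open import Relation.Nullary.Decidable using (does)
  open RingSums R
  open IntegerImage R
  open PartialFractionCoefficients

  private
    ∑-indicator : ∀ n m (X : ℕ → Carrier) → m < n →
                  ∑ (List.upTo n) (λ i → if does (m ℕ.≟ i) then X i else 0#) ≈ X m
    ∑-indicator (suc n) zero    X _ = begin
      ∑ (List.upTo (suc n)) _ ≡⟨ ∑-upTo-suc n _ ⟩
      X 0 + ∑ (List.upTo n) (λ _ → 0#) ≈⟨ +-congˡ (∑-0 (List.upTo n)) ⟩
      X 0 + 0#  ≈⟨ +-identityʳ (X 0) ⟩
      X 0       ∎
    ∑-indicator (suc n) (suc m) X (s≤s m<n) = begin
      ∑ (List.upTo (suc n)) _ ≡⟨ ∑-upTo-suc n _ ⟩
      0# + _    ≈⟨ +-identityˡ _ ⟩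
      _         ≈⟨ ∑-indicator n m (λ i → X (suc i)) m<n ⟩
      X (suc m) ∎

    fromℤ-indicator : ∀ (b : Bool) y → fromℤ (if b then ℤ.1ℤ else ℤ.0ℤ) * y ≈ (if b then y else 0#)
    fromℤ-indicator true  y = trans (*-congʳ (+-identityʳ 1#)) (*-identityˡ y)
    fromℤ-indicator false y = zeroˡ y

    fromℤ-0 : ∀ {x} → x ≡ ℤ.0ℤ → ∀ y → fromℤ x * y ≈ 0#
    fromℤ-0 ≡.refl y = zeroˡ y

  module _ (A B C D : Carrier) where

    pfTerm : ℕ → ℕ → ℕ → Carrier
    pfTerm a b i = fromℤ (pf a b i) * (A ^ i * C ^ (a ℕ.+ b ∸ i)) + fromℤ (pf b a i) * (B ^ i * D ^ (a ℕ.+ b ∸ i))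

  module _ {A B C D : Carrier} (AB≈C[B-A] : A * B ≈ C * (B - A)) (D≈-C : D ≈ - C) where
    private
      term : ℕ → ℕ → ℕ → Carrier
      term = pfTerm A B C D

      term-step : ∀ a b i → C * term a (suc b) i - C * term (suc a) b i ≈ term (suc a) (suc b) i
      term-step a b i with i ℕP.≤? a ℕ.+ suc b
      ... | yes i≤n = begin
        C * (x₁ * (Aⁱ * C ^ (a ℕ.+ suc b ∸ i)) + x₂ * (Bⁱ * D ^ (a ℕ.+ suc b ∸ i)))
          - C * (y₁ * (Aⁱ * C ^ (suc a ℕ.+ b ∸ i)) + y₂ * (Bⁱ * D ^ (suc a ℕ.+ b ∸ i)))
          ≡⟨ ≡.cong (λ m → C * (x₁ * (Aⁱ * Cᵉ) + x₂ * (Bⁱ * Dᵉ)) - C * (y₁ * (Aⁱ * C ^ (m ∸ i)) + y₂ * (Bⁱ * D ^ (m ∸ i))))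
                    (≡.sym (ℕP.+-suc a b)) ⟩
        C * (x₁ * (Aⁱ * Cᵉ) + x₂ * (Bⁱ * Dᵉ)) - C * (y₁ * (Aⁱ * Cᵉ) + y₂ * (Bⁱ * Dᵉ))
          ≈⟨ solve 9 (λ c x₁ x₂ y₁ y₂ aⁱ bⁱ cᵉ dᵉ →
               c :* (x₁ :* (aⁱ :* cᵉ) :+ x₂ :* (bⁱ :* dᵉ)) :- c :* (y₁ :* (aⁱ :* cᵉ) :+ y₂ :* (bⁱ :* dᵉ))
               := (x₁ :- y₁) :* (aⁱ :* (c :* cᵉ)) :+ (y₂ :- x₂) :* (bⁱ :* ((:- c) :* dᵉ))) refl C x₁ x₂ y₁ y₂ Aⁱ Bⁱ Cᵉ Dᵉ ⟩
        (x₁ - y₁) * (Aⁱ * (C * Cᵉ)) + (y₂ - x₂) * (Bⁱ * (- C * Dᵉ))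
          ≈⟨ +-cong (*-congʳ (sym (fromℤ-minus (pf a (suc b) i) (pf (suc a) b i))))
                    (*-cong (sym (fromℤ-minus (pf b (suc a) i) (pf (suc b) a i))) (*-congˡ (*-congʳ (sym D≈-C)))) ⟩
        fromℤ (pf a (suc b) i ℤ.- pf (suc a) b i) * (Aⁱ * (C * Cᵉ)) + fromℤ (pf b (suc a) i ℤ.- pf (suc b) a i) * (Bⁱ * (D * Dᵉ))
          ≡⟨ ≡.cong (λ m → fromℤ (pf a (suc b) i ℤ.- pf (suc a) b i) * (Aⁱ * C ^ m) + fromℤ (pf b (suc a) i ℤ.- pf (suc b) a i) * (Bⁱ * D ^ m))
                    (≡.sym (ℕP.+-∸-assoc 1 i≤n)) ⟩
        term (suc a) (suc b) i ∎
        where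
        open Solver
        x₁ = fromℤ (pf a (suc b) i)
        x₂ = fromℤ (pf (suc b) a i)
        y₁ = fromℤ (pf (suc a) b i)
        y₂ = fromℤ (pf b (suc a) i)
        Aⁱ = A ^ i
        Bⁱ = B ^ i
        Cᵉ = C ^ (a ℕ.+ suc b ∸ i)
        Dᵉ = D ^ (a ℕ.+ suc b ∸ i)
      ... | no i≰n = begin
        C * term a (suc b) i - C * term (suc a) b i
          ≈⟨ +-cong (*-congˡ (+-cong (fromℤ-0 e₁ _) (fromℤ-0 e₃ _))) (-‿cong (*-congˡ (+-cong (fromℤ-0 e₂ _) (fromℤ-0 e₄ _)))) ⟩
        C * (0# + 0#) - C * (0# + 0#) ≈⟨ trans (-‿inverseʳ _) (sym (+-identityˡ 0#)) ⟩
        0# + 0#                       ≈⟨ +-cong (fromℤ-0 (≡.cong₂ ℤ._-_ e₁ e₂) _) (fromℤ-0 (≡.cong₂ ℤ._-_ e₄ e₃) _) ⟨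
        term (suc a) (suc b) i      ∎
        where
        n<i = ℕP.≰⇒> i≰n
        e₁ : pf a (suc b) i ≡ ℤ.0ℤ
        e₁ = pf-vanishes a (suc b) i (ℕP.≤-<-trans (ℕP.m≤m+n a (suc b)) n<i)
        e₂ : pf (suc a) b i ≡ ℤ.0ℤ
        e₂ = pf-vanishes (suc a) b i (ℕP.≤-<-trans (ℕP.≤-trans (ℕP.m≤m+n (suc a) b) (ℕP.≤-reflexive (≡.sym (ℕP.+-suc a b)))) n<i)
        e₃ : pf (suc b) a i ≡ ℤ.0ℤ
        e₃ = pf-vanishes (suc b) a i (ℕP.≤-<-trans (ℕP.m≤n+m (suc b) a) n<i)
        e₄ : pf b (suc a) i ≡ ℤ.0ℤ
        e₄ = pf-vanishes b (suc a) i (ℕP.≤-<-trans (ℕP.≤-trans (ℕP.m≤n+m b (suc a)) (ℕP.≤-reflexive (≡.sym (ℕP.+-suc a b)))) n<i)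

    partialFractions : ∀ a b N → 1 ≤ a ℕ.+ b → a ℕ.+ b ≤ N → A ^ a * B ^ b ≈ ∑ (List.upTo (suc N)) (pfTerm A B C D a b)
    partialFractions (suc a) zero N _ a≤N = sym (begin
      ∑ (List.upTo (suc N)) (term (suc a) zero)
        ≈⟨ ∑-cong (List.upTo (suc N)) (λ i → trans (+-cong (fromℤ-indicator (does (suc a ℕ.≟ i)) _) (zeroˡ _)) (+-identityʳ _)) ⟩
      ∑ (List.upTo (suc N)) (λ i → if does (suc a ℕ.≟ i) then A ^ i * C ^ (suc a ℕ.+ 0 ∸ i) else 0#)
        ≈⟨ ∑-indicator (suc N) (suc a) (λ i → A ^ i * C ^ (suc a ℕ.+ 0 ∸ i)) (s≤s (ℕP.≤-trans (ℕP.≤-reflexive (≡.sym (ℕP.+-identityʳ (suc a)))) a≤N)) ⟩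
      A ^ suc a * C ^ (suc a ℕ.+ 0 ∸ suc a) ≡⟨ ≡.cong (λ m → A ^ suc a * C ^ m) (ℕP.m+n∸m≡n (suc a) 0) ⟩
      A ^ suc a * 1# ∎)
    partialFractions zero (suc b) N _ b≤N = sym (begin
      ∑ (List.upTo (suc N)) (term zero (suc b))
        ≈⟨ ∑-cong (List.upTo (suc N)) (λ i → trans (+-cong (zeroˡ _) (fromℤ-indicator (does (suc b ℕ.≟ i)) _)) (+-identityˡ _)) ⟩
      ∑ (List.upTo (suc N)) (λ i → if does (suc b ℕ.≟ i) then B ^ i * D ^ (suc b ∸ i) else 0#)
        ≈⟨ ∑-indicator (suc N) (suc b) (λ i → B ^ i * D ^ (suc b ∸ i)) (s≤s b≤N) ⟩
      B ^ suc b * D ^ (suc b ∸ suc b) ≡⟨ ≡.cong (λ m → B ^ suc b * D ^ m) (ℕP.n∸n≡0 (suc b)) ⟩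
      B ^ suc b * 1#                  ≈⟨ *-comm _ _ ⟩
      1# * B ^ suc b                  ∎)
    partialFractions (suc a) (suc b) N _ n≤N = begin
      (A * A ^ a) * (B * B ^ b)                 ≈⟨ interchange A (A ^ a) B (B ^ b) ⟩
      (A * B) * (A ^ a * B ^ b)                 ≈⟨ *-congʳ AB≈C[B-A] ⟩
      (C * (B - A)) * (A ^ a * B ^ b)
        ≈⟨ solve 5 (λ A Aᵃ B Bᵇ C → (C :* (B :- A)) :* (Aᵃ :* Bᵇ) := C :* (Aᵃ :* (B :* Bᵇ)) :- C :* ((A :* Aᵃ) :* Bᵇ)) refl A (A ^ a) B (B ^ b) C ⟩
      C * (A ^ a * B ^ suc b) - C * (A ^ suc a * B ^ b)
        ≈⟨ +-cong (*-congˡ (partialFractions a (suc b) N 1≤n₁ n₁≤N)) (-‿cong (*-congˡ (partialFractions (suc a) b N (s≤s z≤n) n₂≤N))) ⟩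
      C * ∑ U (term a (suc b)) - C * ∑ U (term (suc a) b)
        ≈⟨ +-cong (sym (∑-*ˡ U C _)) (trans (-‿cong (sym (∑-*ˡ U C _))) (sym (∑-neg U _))) ⟩
      ∑ U (λ i → C * term a (suc b) i) + ∑ U (λ i → - (C * term (suc a) b i)) ≈⟨ ∑-+ U _ _ ⟨
      ∑ U (λ i → C * term a (suc b) i - C * term (suc a) b i)                ≈⟨ ∑-cong U (term-step a b) ⟩
      ∑ U (term (suc a) (suc b))                                               ∎
      where
      open Solver
      open import Algebra.Properties.CommutativeSemigroup *-commutativeSemigroup using (interchange)
      U = List.upTo (suc N)
      1≤n₁ : 1 ≤ a ℕ.+ suc b
      1≤n₁ = ℕP.≤-trans (s≤s z≤n) (ℕP.≤-reflexive (≡.sym (ℕP.+-suc a b)))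
      n₁≤N : a ℕ.+ suc b ≤ N
      n₁≤N = ℕP.≤-trans (ℕP.n≤1+n _) n≤N
      n₂≤N : suc a ℕ.+ b ≤ N
      n₂≤N = ℕP.≤-trans (ℕP.≤-reflexive (≡.sym (ℕP.+-suc a b))) n₁≤N

module FiniteFieldUnits {c ℓ} {F : CommutativeRing c ℓ} {q} (F-finite : IsFiniteField F q) where
  open CommutativeRing F
  open IsFiniteField F-finite
  open import Relation.Binary.Reasoning.Setoid setoid
  open Removal setoid
  open import Data.List.Relation.Unary.Unique.Setoid setoid using (Unique)
  open RingProperties ring using (-‿involutive; -0#≈0#; -‿+-comm)

  F* : Set (c ⊔ ℓ)
  F* = Σ Carrier (λ x → ¬ x ≈ 0#)

  F*-setoid : Setoid (c ⊔ ℓ) ℓ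
  F*-setoid = On.setoid {B = F*} setoid proj₁

  open import Data.List.Membership.Setoid F*-setoid using () renaming (_∈_ to _∈*_)
  open import Data.List.Relation.Unary.Unique.Setoid F*-setoid using () renaming (Unique to Unique*)

  private
    0∈elems : Any (0# ≈_) elems
    0∈elems = complete 0#

    0≈lookup : 0# ≈ Any.lookup 0∈elems
    0≈lookup = AnyP.lookup-result 0∈elems

    nonzero : List Carrier
    nonzero = elems Any.─ 0∈elems

    nonzero-≉0 : All (λ x → ¬ x ≈ 0#) nonzero
    nonzero-≉0 = All.tabulate (λ x∈ x≈0 →
      ─-apart 0∈elems distinct (Any.map (λ { ≡.refl → refl }) x∈) (trans x≈0 0≈lookup))

    map-proj₁-toList : ∀ {a p} {A : Set a} {P : A → Set p} {xs} (pxs : All P xs) → List.map proj₁ (All.toList pxs) ≡ xs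
    map-proj₁-toList []         = ≡.refl
    map-proj₁-toList (px ∷ pxs) = ≡.cong (_ ∷_) (map-proj₁-toList pxs)

  F*-elements : List F*
  F*-elements = All.toList nonzero-≉0

  F*-complete : ∀ z → z ∈* F*-elements
  F*-complete z with ∈-─⁺ 0∈elems (complete (proj₁ z))
  ... | inj₁ z≈0 = ⊥-elim (proj₂ z (trans z≈0 (sym 0≈lookup)))
  ... | inj₂ z∈  = AnyP.map⁻ (≡.subst (Any (proj₁ z ≈_)) (≡.sym (map-proj₁-toList nonzero-≉0)) z∈)

  F*-unique : Unique* F*-elements
  F*-unique = UniqueP.map⁻ F*-setoid setoid (λ x≈y → x≈y)
    (≡.subst Unique (≡.sym (map-proj₁-toList nonzero-≉0)) (unique-─ 0∈elems distinct))
    where import Data.List.Relation.Unary.Unique.Setoid.Properties as UniqueP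

  F*-length : length F*-elements ≡ q ∸ 1
  F*-length = ≡.trans (≡.sym (ListP.length-map proj₁ F*-elements))
               (≡.trans (≡.cong length (map-proj₁-toList nonzero-≉0))
               (≡.trans (ListP.length-removeAt elems (Any.index 0∈elems)) (≡.cong ℕ.pred card)))

  module _ {c′ ℓ′} (M : CommutativeMonoid c′ ℓ′) where
    private module M = CommutativeMonoid M
    open MonoidSums M

    ∑-elems : (f : Carrier → M.Carrier) → (∀ {x y} → x ≈ y → f x M.≈ f y) →
              ∑ elems f M.≈ f 0# M.∙ ∑ F*-elements (λ ε → f (proj₁ ε))
    ∑-elems f f-resp = M.trans (Reindexing.∑-─ setoid 0∈elems f) (M.∙-cong (f-resp (sym 0≈lookup))
      (M.reflexive (≡.trans (≡.cong (λ xs → ∑ xs f) (≡.sym (map-proj₁-toList nonzero-≉0))) (∑-map F*-elements proj₁ f))))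

  _⁻¹ : F* → Carrier
  (x , x≉0) ⁻¹ = proj₁ (inverse x x≉0)

  x*x⁻¹≈1 : ∀ (x : F*) → proj₁ x * x ⁻¹ ≈ 1#
  x*x⁻¹≈1 (x , x≉0) = proj₂ (inverse x x≉0)

  x⁻¹*x≈1 : ∀ (x : F*) → x ⁻¹ * proj₁ x ≈ 1#
  x⁻¹*x≈1 x = trans (*-comm _ _) (x*x⁻¹≈1 x)

  private
    inverse-unique : ∀ {x y y′} → x * y ≈ 1# → x * y′ ≈ 1# → y ≈ y′
    inverse-unique {x} {y} {y′} xy≈1 xy′≈1 = begin
      y              ≈⟨ *-identityʳ y ⟨
      y * 1#         ≈⟨ *-congˡ xy′≈1 ⟨
      y * (x * y′)   ≈⟨ *-assoc y x y′ ⟨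
      (y * x) * y′   ≈⟨ *-congʳ (trans (*-comm y x) xy≈1) ⟩
      1# * y′        ≈⟨ *-identityˡ y′ ⟩
      y′             ∎

  ⁻¹-cong : ∀ {x y : F*} → proj₁ x ≈ proj₁ y → x ⁻¹ ≈ y ⁻¹
  ⁻¹-cong {x} {y} x≈y = inverse-unique (x*x⁻¹≈1 x) (trans (*-congʳ x≈y) (x*x⁻¹≈1 y))

  ⁻¹-≉0 : ∀ (x : F*) → ¬ x ⁻¹ ≈ 0#
  ⁻¹-≉0 x x⁻¹≈0 = 1≉0 (trans (sym (x*x⁻¹≈1 x)) (trans (*-congˡ x⁻¹≈0) (zeroʳ _)))

  *-≉0 : ∀ {x y} → ¬ x ≈ 0# → ¬ y ≈ 0# → ¬ x * y ≈ 0#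
  *-≉0 {x} {y} x≉0 y≉0 xy≈0 = y≉0 (begin
    y                       ≈⟨ *-identityˡ y ⟨
    1# * y                  ≈⟨ *-congʳ (x⁻¹*x≈1 (x , x≉0)) ⟨
    ((x , x≉0) ⁻¹ * x) * y  ≈⟨ *-assoc _ x y ⟩
    (x , x≉0) ⁻¹ * (x * y)  ≈⟨ *-congˡ xy≈0 ⟩
    (x , x≉0) ⁻¹ * 0#       ≈⟨ zeroʳ _ ⟩
    0#                      ∎)

  -‿≉0 : ∀ {x} → ¬ x ≈ 0# → ¬ - x ≈ 0#
  -‿≉0 {x} x≉0 -x≈0 = x≉0 (trans (sym (-‿involutive x)) (trans (-‿cong -x≈0) -0#≈0#))

  private
    mk↔ : ∀ {a ℓ} {X : Setoid a ℓ} (to from : Setoid.Carrier X → Setoid.Carrier X) →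
          Congruent (Setoid._≈_ X) (Setoid._≈_ X) to → Congruent (Setoid._≈_ X) (Setoid._≈_ X) from →
          StrictlyInverseˡ (Setoid._≈_ X) to from → StrictlyInverseʳ (Setoid._≈_ X) to from → Inverse X X
    mk↔ {X = X} to from to-cong from-cong to∘from from∘to = record
      { to = to ; from = from ; to-cong = to-cong ; from-cong = from-cong
      ; inverse = strictlyInverseˡ⇒inverseˡ to-cong to∘from , strictlyInverseʳ⇒inverseʳ from-cong from∘to }
      where open import Function.Consequences.Setoid X X

    cancelˡ : ∀ (y : F*) x → y ⁻¹ * (proj₁ y * x) ≈ x
    cancelˡ y x = trans (sym (*-assoc _ _ _)) (trans (*-congʳ (x⁻¹*x≈1 y)) (*-identityˡ x))

    cancelʳ : ∀ (y : F*) x → proj₁ y * (y ⁻¹ * x) ≈ x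
    cancelʳ y x = trans (sym (*-assoc _ _ _)) (trans (*-congʳ (x*x⁻¹≈1 y)) (*-identityˡ x))

  scaleBy : F* → Inverse setoid setoid
  scaleBy y = mk↔ (proj₁ y *_) (y ⁻¹ *_) *-congˡ *-congˡ (cancelʳ y) (cancelˡ y)

  translate : Carrier → Inverse setoid setoid
  translate w = mk↔ (_- w) (_+ w) +-congʳ +-congʳ
    (λ x → trans (+-assoc x w (- w)) (trans (+-congˡ (-‿inverseʳ w)) (+-identityʳ x)))
    (λ x → trans (+-assoc x (- w) w) (trans (+-congˡ (-‿inverseˡ w)) (+-identityʳ x)))

  reflect : Carrier → Inverse setoid setoid
  reflect a = mk↔ (λ x → a - x) (λ x → a - x) (λ x≈y → +-congˡ (-‿cong x≈y)) (λ x≈y → +-congˡ (-‿cong x≈y)) a-[a-x]≈x a-[a-x]≈x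
    where
    a-[a-x]≈x : ∀ x → a - (a - x) ≈ x
    a-[a-x]≈x x = begin
      a - (a - x)       ≈⟨ +-congˡ (-‿+-comm a (- x)) ⟨
      a + (- a - - x)   ≈⟨ +-assoc a (- a) (- - x) ⟨
      (a - a) - - x     ≈⟨ +-cong (-‿inverseʳ a) (-‿involutive x) ⟩
      0# + x            ≈⟨ +-identityˡ x ⟩
      x                 ∎

  scaleBy* : F* → Inverse F*-setoid F*-setoid
  scaleBy* y = mk↔ (λ x → proj₁ y * proj₁ x , *-≉0 (proj₂ y) (proj₂ x)) (λ x → y ⁻¹ * proj₁ x , *-≉0 (⁻¹-≉0 y) (proj₂ x))
    *-congˡ *-congˡ (λ x → cancelʳ y (proj₁ x)) (λ x → cancelˡ y (proj₁ x))

  invert* : Inverse F*-setoid F*-setoid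
  invert* = mk↔ inv inv ⁻¹-cong ⁻¹-cong inv-involutive inv-involutive
    where
    inv : F* → F*
    inv x = x ⁻¹ , ⁻¹-≉0 x
    inv-involutive : ∀ x → inv x ⁻¹ ≈ proj₁ x
    inv-involutive x = inverse-unique (x*x⁻¹≈1 (inv x)) (x⁻¹*x≈1 x)

  negate* : Inverse F*-setoid F*-setoid
  negate* = mk↔ neg neg -‿cong -‿cong (λ x → -‿involutive (proj₁ x)) (λ x → -‿involutive (proj₁ x))
    where
    neg : F* → F*
    neg x = - proj₁ x , -‿≉0 (proj₂ x)

module UnitPowerSums {c₁ ℓ₁ c₂ ℓ₂} (S : Setting c₁ ℓ₁ c₂ ℓ₂) where
  open Setting S
  open K using (_≈_; _+_; _*_; -_; _-_; 0#; 1#)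
  open import Relation.Binary.Reasoning.Setoid K.setoid
  open import Algebra.Properties.CommutativeSemiring.Exp K.commutativeSemiring using (_^_; ^-congˡ; ^-homo-*; ^-distrib-*)
  open RingProperties K.ring using (-‿involutive)
  open RingSums K
  open IntegerImage K using (fromℕ; module Solver)
  open FiniteFieldUnits F-finite
  open IsFiniteField F-finite using (elems; complete; distinct; card)
  open IsIntegralDomain K-domain using (noZeroDivisors) renaming (1≉0 to 1≉0ᴷ)
  private
    module ι = RingMorphisms.IsRingMonomorphism ι-mono
    module ∏ = MonoidSums K.*-commutativeMonoid
    module Reindex = MonoidSums.Reindexing K.+-commutativeMonoid F.setoid
    module Reindex* = MonoidSums.Reindexing K.+-commutativeMonoid F*-setoid

  ι-≉0 : ∀ {x} → ¬ x F.≈ F.0# → ¬ ι x ≈ 0#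
  ι-≉0 x≉0 ιx≈0 = x≉0 (ι.injective (K.trans ιx≈0 (K.sym ι.0#-homo)))

  ∑-1 : ∀ {a} {A : Set a} (xs : List A) → ∑ xs (λ _ → 1#) ≈ fromℕ (length xs)
  ∑-1 xs = K.reflexive (∑-const xs 1#)

  -- Translation by 1 permutes 𝔽_r, so adding 1 to every term of ∑ ι x does not change the sum.
  characteristic : fromℕ r ≈ 0#
  characteristic = begin
    fromℕ r                     ≡⟨ ≡.cong fromℕ card ⟨
    fromℕ (length elems)        ≈⟨ ∑-1 elems ⟨
    ∑ elems (λ _ → 1#)          ≈⟨ solve 2 (λ σ n → n := (:- σ) :+ (σ :+ n)) K.refl σ _ ⟩
    - σ + (σ + ∑ elems (λ _ → 1#)) ≈⟨ K.+-congˡ σ+r≈σ ⟩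
    - σ + σ                     ≈⟨ K.-‿inverseˡ σ ⟩
    0#                          ∎
    where
    open Solver
    σ : K.Carrier
    σ = ∑ elems ι
    σ+r≈σ : σ + ∑ elems (λ _ → 1#) ≈ σ
    σ+r≈σ = begin
      σ + ∑ elems (λ _ → 1#)          ≈⟨ ∑-+ elems ι (λ _ → 1#) ⟨
      ∑ elems (λ x → ι x + 1#)        ≈⟨ ∑-cong elems (λ x → K.sym (begin
        ι (x F.- F.- F.1#)              ≈⟨ ι.+-homo x _ ⟩
        ι x + ι (F.- F.- F.1#)          ≈⟨ K.+-congˡ (K.trans (ι.-‿homo _) (K.-‿cong (ι.-‿homo F.1#))) ⟩
        ι x + - - ι F.1#                ≈⟨ K.+-congˡ (K.trans (-‿involutive _) ι.1#-homo) ⟩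
        ι x + 1#                        ∎)) ⟩
      ∑ elems (λ x → ι (x F.- F.- F.1#)) ≈⟨ Reindex.∑-reindex complete distinct (translate (F.- F.1#)) ι ι.⟦⟧-cong ⟩
      σ                               ∎

  r-1≈-1 : fromℕ (r ∸ 1) ≈ - 1#
  r-1≈-1 = begin
    fromℕ (r ∸ 1)                          ≡⟨ ≡.cong fromℕ F*-length ⟨
    fromℕ (length F*-elements)             ≈⟨ ∑-1 F*-elements ⟨
    ∑ F*-elements (λ _ → 1#)               ≈⟨ solve 2 (λ n o → n := (:- o) :+ (o :+ n)) K.refl _ 1# ⟩
    - 1# + (1# + ∑ F*-elements (λ _ → 1#)) ≈⟨ K.+-congˡ (∑-elems K.+-commutativeMonoid (λ _ → 1#) (λ _ → K.refl)) ⟨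
    - 1# + ∑ elems (λ _ → 1#)              ≈⟨ K.+-congˡ (K.trans (∑-1 elems) (K.trans (K.reflexive (≡.cong fromℕ card)) characteristic)) ⟩
    - 1# + 0#                              ≈⟨ K.+-identityʳ _ ⟩
    - 1#                                   ∎
    where open Solver

  private
    ∏-≉0 : ∀ (xs : List F*) → ¬ ∏.∑ xs (λ x → ι (proj₁ x)) ≈ 0#
    ∏-≉0 []       1≈0 = 1≉0ᴷ 1≈0
    ∏-≉0 (x ∷ xs) ∏≈0 with noZeroDivisors _ _ ∏≈0
    ... | inj₁ x≈0  = ι-≉0 (proj₂ x) x≈0
    ... | inj₂ xs≈0 = ∏-≉0 xs xs≈0

    cancel-nonzero : ∀ {x y} → ¬ y ≈ 0# → x * y ≈ y → x ≈ 1#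
    cancel-nonzero {x} {y} y≉0 xy≈y with noZeroDivisors (x - 1#) y (begin
      (x - 1#) * y    ≈⟨ solve 3 (λ x y o → (x :- o) :* y := x :* y :- y :* o) K.refl x y 1# ⟩
      x * y - y * 1#  ≈⟨ K.+-cong xy≈y (K.-‿cong (K.*-identityʳ y)) ⟩
      y - y           ≈⟨ K.-‿inverseʳ y ⟩
      0#              ∎)
      where open Solver
    ... | inj₁ x-1≈0 = K.trans (solve 2 (λ x o → x := (x :- o) :+ o) K.refl x 1#) (K.trans (K.+-congʳ x-1≈0) (K.+-identityˡ 1#))
      where open Solver
    ... | inj₂ y≈0   = ⊥-elim (y≉0 y≈0)

  -- Multiplication by y permutes 𝔽_r^×, and the product of its elements is nonzero in the domain 𝕂.
  fermat : ∀ (y : F*) → ι (proj₁ y) ^ (r ∸ 1) ≈ 1#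
  fermat y = cancel-nonzero (∏-≉0 F*-elements) (begin
    ι y₁ ^ (r ∸ 1) * P                                    ≡⟨ ≡.cong (λ n → ι y₁ ^ n * P) F*-length ⟨
    ι y₁ ^ length F*-elements * P                         ≡⟨ ≡.cong (_* P) (∏.∑-const F*-elements (ι y₁)) ⟨
    ∏.∑ F*-elements (λ _ → ι y₁) * P                      ≈⟨ ∏.∑-∙ F*-elements (λ _ → ι y₁) (λ x → ι (proj₁ x)) ⟨
    ∏.∑ F*-elements (λ x → ι y₁ * ι (proj₁ x))            ≈⟨ ∏.∑-cong F*-elements (λ x → K.sym (ι.*-homo y₁ (proj₁ x))) ⟩
    ∏.∑ F*-elements (λ x → ι (y₁ F.* proj₁ x))            ≈⟨ ∏.Reindexing.∑-reindex F*-setoid F*-complete F*-unique (scaleBy* y) (λ x → ι (proj₁ x)) ι.⟦⟧-cong ⟩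
    P                                                     ∎)
    where
    y₁ = proj₁ y
    P = ∏.∑ F*-elements (λ x → ι (proj₁ x))

  unitPowerSum : ℕ → K.Carrier
  unitPowerSum j = ∑ F*-elements (λ ε → ι (proj₁ ε) ^ j)

  private
    ^-multiple≈1 : ∀ x n q → x ^ n ≈ 1# → x ^ (q ℕ.* n) ≈ 1#
    ^-multiple≈1 x n zero    _      = K.refl
    ^-multiple≈1 x n (suc q) xⁿ≈1 =
      K.trans (^-homo-* x n (q ℕ.* n)) (K.trans (K.*-cong xⁿ≈1 (^-multiple≈1 x n q xⁿ≈1)) (K.*-identityˡ 1#))

    unitPowerSum-periodic : ∀ t q → unitPowerSum (t ℕ.+ q ℕ.* (r ∸ 1)) ≈ unitPowerSum t
    unitPowerSum-periodic t q = ∑-cong F*-elements (λ ε → begin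
      ι (proj₁ ε) ^ (t ℕ.+ q ℕ.* (r ∸ 1))               ≈⟨ ^-homo-* _ t (q ℕ.* (r ∸ 1)) ⟩
      ι (proj₁ ε) ^ t * ι (proj₁ ε) ^ (q ℕ.* (r ∸ 1))   ≈⟨ K.*-congˡ (^-multiple≈1 _ (r ∸ 1) q (fermat ε)) ⟩
      ι (proj₁ ε) ^ t * 1#                              ≈⟨ K.*-identityʳ _ ⟩
      ι (proj₁ ε) ^ t                                   ∎)

  unitPowerSum-divisible : ∀ j → (r ∸ 1) ∣ j → unitPowerSum j ≈ - 1#
  unitPowerSum-divisible j (divides q j≡q[r-1]) = begin
    unitPowerSum j                      ≡⟨ ≡.cong unitPowerSum j≡q[r-1] ⟩
    unitPowerSum (0 ℕ.+ q ℕ.* (r ∸ 1))  ≈⟨ unitPowerSum-periodic 0 q ⟩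
    ∑ F*-elements (λ _ → 1#)            ≈⟨ ∑-1 F*-elements ⟩
    fromℕ (length F*-elements)          ≡⟨ ≡.cong fromℕ F*-length ⟩
    fromℕ (r ∸ 1)                       ≈⟨ r-1≈-1 ⟩
    - 1#                                ∎

  private
    module _ (t : ℕ) where
      σ : K.Carrier
      σ = unitPowerSum t

      σ-scaled : ∀ (y : F*) → ι (proj₁ y) ^ t * σ ≈ σ
      σ-scaled y = begin
        ι (proj₁ y) ^ t * σ                                     ≈⟨ ∑-*ˡ F*-elements _ _ ⟨
        ∑ F*-elements (λ ε → ι (proj₁ y) ^ t * ι (proj₁ ε) ^ t) ≈⟨ ∑-cong F*-elements (λ ε →
                                                                     K.trans (^-congˡ t (ι.*-homo _ _)) (^-distrib-* _ _ t)) ⟨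
        ∑ F*-elements (λ ε → ι (proj₁ y F.* proj₁ ε) ^ t)       ≈⟨ Reindex*.∑-reindex F*-complete F*-unique (scaleBy* y)
                                                                     (λ ε → ι (proj₁ ε) ^ t) (λ x≈y → ^-congˡ t (ι.⟦⟧-cong x≈y)) ⟩
        σ                                                       ∎

      σ≈0⊎root : ∀ (y : F*) → σ ≈ 0# ⊎ ι (proj₁ y) ^ t ≈ 1#
      σ≈0⊎root y with noZeroDivisors σ (ι (proj₁ y) ^ t - 1#) (begin
        σ * (ι (proj₁ y) ^ t - 1#)       ≈⟨ solve 3 (λ s x o → s :* (x :- o) := x :* s :- s :* o) K.refl σ _ 1# ⟩
        ι (proj₁ y) ^ t * σ - σ * 1#     ≈⟨ K.+-cong (σ-scaled y) (K.-‿cong (K.*-identityʳ σ)) ⟩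
        σ - σ                            ≈⟨ K.-‿inverseʳ σ ⟩
        0#                               ∎)
        where open Solver
      ... | inj₁ σ≈0 = inj₁ σ≈0
      ... | inj₂ yᵗ-1≈0 = inj₂ (K.trans (solve 2 (λ x o → x := (x :- o) :+ o) K.refl _ 1#) (K.trans (K.+-congʳ yᵗ-1≈0) (K.+-identityˡ 1#)))
        where open Solver

      σ≈0⊎allRoots : ∀ xs → σ ≈ 0# ⊎ All (λ y → ι (proj₁ y) ^ t ≈ 1#) xs
      σ≈0⊎allRoots []       = inj₂ []
      σ≈0⊎allRoots (y ∷ xs) with σ≈0⊎root y | σ≈0⊎allRoots xs
      ... | inj₁ σ≈0 | _          = inj₁ σ≈0
      ... | inj₂ _   | inj₁ σ≈0   = inj₁ σ≈0
      ... | inj₂ yᵗ≈1 | inj₂ rest = inj₂ (yᵗ≈1 ∷ rest)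

    -- yᵗ σ = σ for every y ∈ 𝔽_r^×, but Xᵗ = 1 has at most t < r - 1 roots in 𝕂.
    unitPowerSum-small : ∀ t → 1 ≤ t → t < r ∸ 1 → unitPowerSum t ≈ 0#
    unitPowerSum-small (suc t) _ t<r-1 with σ≈0⊎allRoots (suc t) F*-elements
    ... | inj₁ σ≈0  = σ≈0
    ... | inj₂ roots = ⊥-elim (ℕP.<⇒≱ t<r-1 (ℕP.≤-trans (ℕP.≤-reflexive |F*|≡r-1)
        (PolynomialRoots.rootsOfUnity-length K K-domain t (UniqueP.map⁺ F*-setoid K.setoid ι.injective F*-unique) (AllP.map⁺ roots))))
      where
      import Data.List.Relation.Unary.Unique.Setoid.Properties as UniqueP
      |F*|≡r-1 : r ∸ 1 ≡ length (List.map (λ x → ι (proj₁ x)) F*-elements)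
      |F*|≡r-1 = ≡.trans (≡.sym F*-length) (≡.sym (ListP.length-map _ F*-elements))

  unitPowerSum-indivisible : ∀ j → ¬ (r ∸ 1) ∣ j → unitPowerSum j ≈ 0#
  unitPowerSum-indivisible j ∤j = begin
    unitPowerSum j                                      ≡⟨ ≡.cong unitPowerSum (m≡m%n+[m/n]*n j (r ∸ 1)) ⟩
    unitPowerSum (j % (r ∸ 1) ℕ.+ j / (r ∸ 1) ℕ.* (r ∸ 1)) ≈⟨ unitPowerSum-periodic (j % (r ∸ 1)) (j / (r ∸ 1)) ⟩
    unitPowerSum (j % (r ∸ 1))                          ≈⟨ unitPowerSum-small (j % (r ∸ 1)) 1≤j%[r-1] (m%n<n j (r ∸ 1)) ⟩
    0#                                                  ∎
    where
    instance
      r-1≢0 : ℕ.NonZero (r ∸ 1)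
      r-1≢0 = ℕ.>-nonZero (≡.subst (1 ≤_) F*-length (nonempty (F*-complete (F.1# , IsFiniteField.1≉0 F-finite))))
        where
        nonempty : ∀ {p} {P : F* → Set p} {xs} → Any P xs → 1 ≤ length xs
        nonempty (here _)  = s≤s z≤n
        nonempty (there _) = s≤s z≤n
    1≤j%[r-1] : 1 ≤ j % (r ∸ 1)
    1≤j%[r-1] with j % (r ∸ 1) in j%≡
    ... | zero  = ⊥-elim (∤j (m%n≡0⇒n∣m j (r ∸ 1) j%≡))
    ... | suc _ = s≤s z≤n

  unitPowerSum-inverse : ∀ j → ∑ F*-elements (λ ε → ι (ε ⁻¹) ^ j) ≈ unitPowerSum j
  unitPowerSum-inverse j = Reindex*.∑-reindex F*-complete F*-unique invert* (λ ε → ι (proj₁ ε) ^ j) (λ x≈y → ^-congˡ j (ι.⟦⟧-cong x≈y))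

  unitPowerSum-negatedInverse : ∀ j → ∑ F*-elements (λ ε → ι (F.- ε ⁻¹) ^ j) ≈ unitPowerSum j
  unitPowerSum-negatedInverse j = K.trans
    (Reindex*.∑-reindex F*-complete F*-unique invert* (λ ε → ι (F.- proj₁ ε) ^ j) (λ x≈y → ^-congˡ j (ι.⟦⟧-cong (F.-‿cong x≈y))))
    (Reindex*.∑-reindex F*-complete F*-unique negate* (λ ε → ι (proj₁ ε) ^ j) (λ x≈y → ^-congˡ j (ι.⟦⟧-cong x≈y)))

module Monics {c₁ ℓ₁ c₂ ℓ₂} (S : Setting c₁ ℓ₁ c₂ ℓ₂) where
  open Setting S
  open K using (_≈_; _+_; _*_; -_; _-_; 0#; 1#)
  open import Relation.Binary.Reasoning.Setoid K.setoid
  open RingProperties K.ring using (-1*x≈-x)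
  private module ι = RingMorphisms.IsRingMonomorphism ι-mono

  _≋_ : ∀ {n} → Vec F.Carrier n → Vec F.Carrier n → Set (c₁ ⊔ ℓ₁)
  _≋_ = Pointwise F._≈_

  ≋-refl : ∀ {n} {v : Vec F.Carrier n} → v ≋ v
  ≋-refl = Pointwise.refl F.refl

  ≡⇒≋ : ∀ {n} {u v : Vec F.Carrier n} → u ≡ v → u ≋ v
  ≡⇒≋ ≡.refl = ≋-refl

  ∷ʳ-cong : ∀ {n} {u v : Vec F.Carrier n} {x y} → u ≋ v → x F.≈ y → (u ∷ʳ x) ≋ (v ∷ʳ y)
  ∷ʳ-cong []         x≈y = x≈y ∷ []
  ∷ʳ-cong (u≈ ∷ u≈s) x≈y = u≈ ∷ ∷ʳ-cong u≈s x≈y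

  pad : ∀ {m} n → Vec F.Carrier m → Vec F.Carrier n
  pad zero    _       = []
  pad (suc n) []      = F.0# ∷ pad n []
  pad (suc n) (x ∷ v) = x ∷ pad n v

  private
    pad-[] : ∀ n → pad n [] ≡ Vec.replicate n F.0#
    pad-[] zero    = ≡.refl
    pad-[] (suc n) = ≡.cong (F.0# ∷_) (pad-[] n)

    pad-cong : ∀ {m} n {u v : Vec F.Carrier m} → u ≋ v → pad n u ≋ pad n v
    pad-cong zero    _            = []
    pad-cong (suc n) []           = F.refl ∷ pad-cong n []
    pad-cong (suc n) (u≈ ∷ u≈s)  = u≈ ∷ pad-cong n u≈s

    pad-zipWith : ∀ {m} n (u v : Vec F.Carrier m) → pad n (zipWith F._+_ u v) ≋ zipWith F._+_ (pad n u) (pad n v)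
    pad-zipWith zero    u       v       = []
    pad-zipWith (suc n) []      []      = F.sym (F.+-identityʳ F.0#) ∷ pad-zipWith n [] []
    pad-zipWith (suc n) (x ∷ u) (y ∷ v) = F.refl ∷ pad-zipWith n u v

    pad-map : ∀ {m} n ε (u : Vec F.Carrier m) → pad n (Vec.map (ε F.*_) u) ≋ Vec.map (ε F.*_) (pad n u)
    pad-map zero    ε u       = []
    pad-map (suc n) ε []      = F.sym (F.zeroʳ ε) ∷ pad-map n ε []
    pad-map (suc n) ε (x ∷ u) = F.refl ∷ pad-map n ε u

    pad-∷ʳ0 : ∀ {m} n (v : Vec F.Carrier m) → pad n (v ∷ʳ F.0#) ≡ pad n v
    pad-∷ʳ0 zero    v       = ≡.refl
    pad-∷ʳ0 (suc n) []      = ≡.refl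
    pad-∷ʳ0 (suc n) (x ∷ v) = ≡.cong (x ∷_) (pad-∷ʳ0 n v)

    pad-pad : ∀ {l} n m (v : Vec F.Carrier l) → l ≤ m → pad n (pad m v) ≡ pad n v
    pad-pad zero    m       v       _         = ≡.refl
    pad-pad (suc n) zero    []      _         = ≡.refl
    pad-pad (suc n) (suc m) []      _         = ≡.cong (F.0# ∷_) (pad-pad n m [] z≤n)
    pad-pad (suc n) (suc m) (x ∷ v) (s≤s l≤m) = ≡.cong (x ∷_) (pad-pad n m v l≤m)

  pad-id : ∀ {n} (v : Vec F.Carrier n) → pad n v ≡ v
  pad-id []      = ≡.refl
  pad-id (x ∷ v) = ≡.cong (x ∷_) (pad-id v)

  pad-suc : ∀ {l} d (w : Vec F.Carrier l) → l ≤ d → pad (suc d) w ≡ pad d w ∷ʳ F.0#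
  pad-suc zero    []      _         = ≡.refl
  pad-suc (suc d) []      _         = ≡.cong (F.0# ∷_) (pad-suc d [] z≤n)
  pad-suc (suc d) (x ∷ w) (s≤s l≤d) = ≡.cong (x ∷_) (pad-suc d w l≤d)

  monic≡pad : ∀ n (k : Fin n) (c : Vec F.Carrier (toℕ k)) → monic F.0# F.1# n k c ≡ pad n (c ∷ʳ F.1#)
  monic≡pad (suc n) Fin.zero    []      = ≡.cong (F.1# ∷_) (≡.sym (pad-[] n))
  monic≡pad (suc n) (Fin.suc k) (x ∷ c) = ≡.cong (x ∷_) (monic≡pad n k c)

  -- ⟦_⟧ on coefficient vectors of any length, padded with zeros (or truncated) to length d₀.
  ⟦_⟧ᵥ : ∀ {m} → Vec F.Carrier m → K.Carrier
  ⟦ v ⟧ᵥ = ⟦ pad d₀ v ⟧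

  ⟦⟧ᵥ-cong : ∀ {m} {u v : Vec F.Carrier m} → u ≋ v → ⟦ u ⟧ᵥ ≈ ⟦ v ⟧ᵥ
  ⟦⟧ᵥ-cong u≋v = ⟦⟧-cong (pad-cong d₀ u≋v)

  ⟦⟧ᵥ-add : ∀ {m} (u v : Vec F.Carrier m) → ⟦ zipWith F._+_ u v ⟧ᵥ ≈ ⟦ u ⟧ᵥ + ⟦ v ⟧ᵥ
  ⟦⟧ᵥ-add u v = K.trans (⟦⟧-cong (pad-zipWith d₀ u v)) (⟦⟧-add (pad d₀ u) (pad d₀ v))

  ⟦⟧ᵥ-scal : ∀ {m} ε (u : Vec F.Carrier m) → ⟦ Vec.map (ε F.*_) u ⟧ᵥ ≈ ι ε * ⟦ u ⟧ᵥ
  ⟦⟧ᵥ-scal ε u = K.trans (⟦⟧-cong (pad-map d₀ ε u)) (⟦⟧-scal ε (pad d₀ u))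

  ⟦⟧ᵥ-pad : ∀ {l} m (v : Vec F.Carrier l) → l ≤ m → ⟦ pad m v ⟧ᵥ ≈ ⟦ v ⟧ᵥ
  ⟦⟧ᵥ-pad m v l≤m = K.reflexive (≡.cong ⟦_⟧ (pad-pad d₀ m v l≤m))

  ⟦monic⟧ : (k : Fin d₀) → Vec F.Carrier (toℕ k) → K.Carrier
  ⟦monic⟧ k c = ⟦ monic F.0# F.1# d₀ k c ⟧

  ⟦monic⟧≡ : ∀ (k : Fin d₀) (c : Vec F.Carrier (toℕ k)) → ⟦monic⟧ k c ≡ ⟦ c ∷ʳ F.1# ⟧ᵥ
  ⟦monic⟧≡ k c = ≡.cong ⟦_⟧ (monic≡pad d₀ k c)

  ⟦monic⟧*inv≈1 : ∀ k c → ⟦monic⟧ k c * inv k c ≈ 1#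
  ⟦monic⟧*inv≈1 k c = proj₂ (⟦⟧-unit k c)

  _⊖_ : ∀ {n} → Vec F.Carrier n → Vec F.Carrier n → Vec F.Carrier n
  _⊖_ = zipWith F._-_

  ⊖-cong : ∀ {n} {a a′ δ δ′ : Vec F.Carrier n} → a ≋ a′ → δ ≋ δ′ → (a ⊖ δ) ≋ (a′ ⊖ δ′)
  ⊖-cong []         []         = []
  ⊖-cong (a≈ ∷ a≈s) (δ≈ ∷ δ≈s) = F.+-cong a≈ (F.-‿cong δ≈) ∷ ⊖-cong a≈s δ≈s

  ⊖-zero : ∀ {n} (a : Vec F.Carrier n) → (a ⊖ Vec.replicate n F.0#) ≋ a
  ⊖-zero []      = []
  ⊖-zero (x ∷ a) = F.trans (F.+-congˡ (RingProperties.-0#≈0# F.ring)) (F.+-identityʳ x) ∷ ⊖-zero a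

  ⟦monic-⊖⟧ : ∀ {n} (u v : Vec F.Carrier n) → ⟦ (u ⊖ v) ∷ʳ F.1# ⟧ᵥ ≈ ⟦ u ∷ʳ F.1# ⟧ᵥ - ⟦ v ⟧ᵥ
  ⟦monic-⊖⟧ u v = begin
    ⟦ (u ⊖ v) ∷ʳ F.1# ⟧ᵥ                                               ≈⟨ ⟦⟧ᵥ-cong (decompose u v) ⟩
    ⟦ zipWith F._+_ (u ∷ʳ F.1#) (Vec.map ((F.- F.1#) F.*_) (v ∷ʳ F.0#)) ⟧ᵥ ≈⟨ ⟦⟧ᵥ-add _ _ ⟩
    ⟦ u ∷ʳ F.1# ⟧ᵥ + ⟦ Vec.map ((F.- F.1#) F.*_) (v ∷ʳ F.0#) ⟧ᵥ        ≈⟨ K.+-congˡ (⟦⟧ᵥ-scal _ _) ⟩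
    ⟦ u ∷ʳ F.1# ⟧ᵥ + ι (F.- F.1#) * ⟦ v ∷ʳ F.0# ⟧ᵥ                     ≈⟨ K.+-congˡ (K.*-cong (K.trans (ι.-‿homo F.1#) (K.-‿cong ι.1#-homo))
                                                                                              (K.reflexive (≡.cong ⟦_⟧ (pad-∷ʳ0 d₀ v)))) ⟩
    ⟦ u ∷ʳ F.1# ⟧ᵥ + - 1# * ⟦ v ⟧ᵥ                                     ≈⟨ K.+-congˡ (-1*x≈-x _) ⟩
    ⟦ u ∷ʳ F.1# ⟧ᵥ - ⟦ v ⟧ᵥ                                            ∎
    where
    decompose : ∀ {n} (u v : Vec F.Carrier n) → ((u ⊖ v) ∷ʳ F.1#) ≋ zipWith F._+_ (u ∷ʳ F.1#) (Vec.map ((F.- F.1#) F.*_) (v ∷ʳ F.0#))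
    decompose []      []      = F.sym (F.trans (F.+-congˡ (F.zeroʳ _)) (F.+-identityʳ _)) ∷ []
    decompose (x ∷ u) (y ∷ v) = F.+-congˡ (F.sym (RingProperties.-1*x≈-x F.ring y)) ∷ decompose u v

  inv-cong : ∀ k {c c′ : Vec F.Carrier (toℕ k)} → c ≋ c′ → inv k c ≈ inv k c′
  inv-cong k {c} {c′} c≋c′ = begin
    inv k c                                 ≈⟨ K.*-identityʳ _ ⟨
    inv k c * 1#                            ≈⟨ K.*-congˡ (⟦monic⟧*inv≈1 k c′) ⟨
    inv k c * (⟦monic⟧ k c′ * inv k c′)     ≈⟨ K.*-congˡ (K.*-congʳ ⟦c⟧≈⟦c′⟧) ⟨
    inv k c * (⟦monic⟧ k c * inv k c′)      ≈⟨ K.*-assoc _ _ _ ⟨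
    (inv k c * ⟦monic⟧ k c) * inv k c′      ≈⟨ K.*-congʳ (K.trans (K.*-comm _ _) (⟦monic⟧*inv≈1 k c)) ⟩
    1# * inv k c′                           ≈⟨ K.*-identityˡ _ ⟩
    inv k c′                                ∎
    where
    ⟦c⟧≈⟦c′⟧ : ⟦monic⟧ k c ≈ ⟦monic⟧ k c′
    ⟦c⟧≈⟦c′⟧ = K.trans (K.reflexive (⟦monic⟧≡ k c)) (K.trans (⟦⟧ᵥ-cong (∷ʳ-cong c≋c′ F.refl)) (K.reflexive (≡.sym (⟦monic⟧≡ k c′))))

module CoefficientSums {c₁ ℓ₁ c₂ ℓ₂} (S : Setting c₁ ℓ₁ c₂ ℓ₂) where
  open Setting S
  open K using (_≈_; _+_; _*_; -_; _-_; 0#; 1#)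
  open import Relation.Binary.Reasoning.Setoid K.setoid
  open RingSums K
  open FiniteFieldUnits F-finite
  open IsFiniteField F-finite using (elems; complete; distinct)
  open Monics S
  open import Algebra.Properties.CommutativeSemiring.Exp K.commutativeSemiring using (_^_)
  private module Reindex = MonoidSums.Reindexing K.+-commutativeMonoid F.setoid

  ∑ᵛ : ∀ m → (Vec F.Carrier m → K.Carrier) → K.Carrier
  ∑ᵛ m g = ∑ (tuples elems m) g

  Respects≋ : ∀ {m} → (Vec F.Carrier m → K.Carrier) → Set (c₁ ⊔ ℓ₁ ⊔ ℓ₂)
  Respects≋ g = ∀ {u v} → u ≋ v → g u ≈ g v

  ∑ᵛ-cong : ∀ m {g h : Vec F.Carrier m → K.Carrier} → (∀ v → g v ≈ h v) → ∑ᵛ m g ≈ ∑ᵛ m h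
  ∑ᵛ-cong m = ∑-cong (tuples elems m)

  ∑ᵛ-∷ : ∀ m (g : Vec F.Carrier (suc m) → K.Carrier) → ∑ᵛ (suc m) g ≈ ∑ elems (λ x → ∑ᵛ m (λ v → g (x ∷ v)))
  ∑ᵛ-∷ m g = K.trans (∑-concatMap elems (λ x → List.map (x ∷_) (tuples elems m)) g)
                     (∑-cong elems (λ x → K.reflexive (∑-map (tuples elems m) (x ∷_) g)))

  ∑ᵛ-∷ʳ : ∀ m (g : Vec F.Carrier (suc m) → K.Carrier) → ∑ᵛ (suc m) g ≈ ∑ elems (λ x → ∑ᵛ m (λ v → g (v ∷ʳ x)))
  ∑ᵛ-∷ʳ zero    g = ∑ᵛ-∷ zero g
  ∑ᵛ-∷ʳ (suc m) g = begin
    ∑ᵛ (suc (suc m)) g                                           ≈⟨ ∑ᵛ-∷ (suc m) g ⟩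
    ∑ elems (λ y → ∑ᵛ (suc m) (λ v → g (y ∷ v)))                 ≈⟨ ∑-cong elems (λ y → ∑ᵛ-∷ʳ m (λ v → g (y ∷ v))) ⟩
    ∑ elems (λ y → ∑ elems (λ x → ∑ᵛ m (λ v → g (y ∷ (v ∷ʳ x))))) ≈⟨ ∑-swap elems elems _ ⟩
    ∑ elems (λ x → ∑ elems (λ y → ∑ᵛ m (λ v → g (y ∷ (v ∷ʳ x))))) ≈⟨ ∑-cong elems (λ x → ∑ᵛ-∷ m (λ w → g (w ∷ʳ x))) ⟨
    ∑ elems (λ x → ∑ᵛ (suc m) (λ w → g (w ∷ʳ x)))                ∎

  ∑ᵛ-reindex : ∀ m (σs : Vec (Inverse F.setoid F.setoid) m) (g : Vec F.Carrier m → K.Carrier) → Respects≋ g →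
               ∑ᵛ m (λ v → g (zipWith Inverse.to σs v)) ≈ ∑ᵛ m g
  ∑ᵛ-reindex zero    []       g g-resp = K.refl
  ∑ᵛ-reindex (suc m) (σ ∷ σs) g g-resp = begin
    ∑ᵛ (suc m) (λ v → g (zipWith Inverse.to (σ ∷ σs) v))             ≈⟨ ∑ᵛ-∷ m _ ⟩
    ∑ elems (λ x → ∑ᵛ m (λ v → g (Inverse.to σ x ∷ zipWith Inverse.to σs v)))
      ≈⟨ ∑-cong elems (λ x → ∑ᵛ-reindex m σs (λ v → g (Inverse.to σ x ∷ v)) (λ u≋v → g-resp (F.refl ∷ u≋v))) ⟩
    ∑ elems (λ x → ∑ᵛ m (λ v → g (Inverse.to σ x ∷ v)))
      ≈⟨ Reindex.∑-reindex complete distinct σ (λ x → ∑ᵛ m (λ v → g (x ∷ v))) (λ x≈y → ∑ᵛ-cong m (λ v → g-resp (x≈y ∷ ≋-refl))) ⟩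
    ∑ elems (λ x → ∑ᵛ m (λ v → g (x ∷ v)))                            ≈⟨ ∑ᵛ-∷ m g ⟨
    ∑ᵛ (suc m) g                                                      ∎

  -- A sum over the nonzero polynomials of degree < d, each written uniquely as ε · (monic of degree k < d).
  ∑ᵐ : ℕ → ((k : Fin d₀) → F* → Vec F.Carrier (toℕ k) → K.Carrier) → K.Carrier
  ∑ᵐ d Φ = ∑ (List.allFin d₀) (λ k → if toℕ k <ᵇ d then ∑ F*-elements (λ ε → ∑ᵛ (toℕ k) (Φ k ε)) else 0#)

  if-cong : ∀ (b : Bool) {x y : K.Carrier} → (Data.Bool.T b → x ≈ y) → (if b then x else 0#) ≈ (if b then y else 0#)
  if-cong true  x≈y = x≈y tt
  if-cong false _   = K.refl

  private
    if-+ : ∀ (b : Bool) x y → (if b then x + y else 0#) ≈ (if b then x else 0#) + (if b then y else 0#)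
    if-+ true  x y = K.refl
    if-+ false x y = K.sym (K.+-identityˡ 0#)

    if-* : ∀ (b : Bool) x y → (if b then x * y else 0#) ≈ x * (if b then y else 0#)
    if-* true  x y = K.refl
    if-* false x y = K.sym (K.zeroʳ x)

  ∑ᵐ-cong : ∀ d {Φ Ψ} → (∀ k → toℕ k < d → ∀ ε c → Φ k ε c ≈ Ψ k ε c) → ∑ᵐ d Φ ≈ ∑ᵐ d Ψ
  ∑ᵐ-cong d Φ≈Ψ = ∑-cong (List.allFin d₀) (λ k → if-cong (toℕ k <ᵇ d) (λ k<d →
    ∑-cong F*-elements (λ ε → ∑ᵛ-cong (toℕ k) (Φ≈Ψ k (ℕP.<ᵇ⇒< (toℕ k) d k<d) ε))))

  scaledMonic : ∀ d {k} → F* → Vec F.Carrier k → Vec F.Carrier d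
  scaledMonic d ε c = Vec.map (proj₁ ε F.*_) (pad d (c ∷ʳ F.1#))

  private
    Decomposition : ℕ → Set (c₁ ⊔ ℓ₁ ⊔ c₂ ⊔ ℓ₂)
    Decomposition d = (g : Vec F.Carrier d → K.Carrier) → Respects≋ g →
                      ∑ᵛ d g ≈ g (Vec.replicate d F.0#) + ∑ᵐ d (λ k ε c → g (scaledMonic d ε c))

    replicate-∷ʳ : ∀ n → Vec.replicate n F.0# ∷ʳ F.0# ≡ Vec.replicate (suc n) F.0#
    replicate-∷ʳ zero    = ≡.refl
    replicate-∷ʳ (suc n) = ≡.cong (F.0# ∷_) (replicate-∷ʳ n)

    map-∷ʳ : ∀ {n} (f : F.Carrier → F.Carrier) (v : Vec F.Carrier n) x → Vec.map f (v ∷ʳ x) ≡ Vec.map f v ∷ʳ f x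
    map-∷ʳ f []      x = ≡.refl
    map-∷ʳ f (y ∷ v) x = ≡.cong (f y ∷_) (map-∷ʳ f v x)

    zipWith-scaleBy : ∀ {n} ε (c : Vec F.Carrier n) → zipWith Inverse.to (Vec.replicate n (scaleBy ε)) c ≡ Vec.map (proj₁ ε F.*_) c
    zipWith-scaleBy ε []      = ≡.refl
    zipWith-scaleBy ε (x ∷ c) = ≡.cong (_ ∷_) (zipWith-scaleBy ε c)

    decomposition-step : (k : Fin d₀) → Decomposition (toℕ k) → Decomposition (suc (toℕ k))
    decomposition-step k IH g g-resp = begin
      ∑ᵛ (suc d) g                                                 ≈⟨ ∑ᵛ-∷ʳ d g ⟩
      ∑ elems (λ x → ∑ᵛ d (λ v → g (v ∷ʳ x)))                      ≈⟨ ∑-elems K.+-commutativeMonoid _ (λ x≈y → ∑ᵛ-cong d (λ v → g-resp (∷ʳ-cong ≋-refl x≈y))) ⟩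
      ∑ᵛ d g₀ + ∑ F*-elements (λ ε → ∑ᵛ d (λ v → g (v ∷ʳ proj₁ ε))) ≈⟨ K.+-cong (IH g₀ (λ u≋v → g-resp (∷ʳ-cong u≋v F.refl))) top ⟩
      (g₀ (Vec.replicate d F.0#) + ∑ᵐ d Φ₀) + Φtop                  ≈⟨ K.+-assoc _ _ _ ⟩
      g₀ (Vec.replicate d F.0#) + (∑ᵐ d Φ₀ + Φtop)                  ≡⟨ ≡.cong (λ v → g v + (∑ᵐ d Φ₀ + Φtop)) (replicate-∷ʳ d) ⟩
      g (Vec.replicate (suc d) F.0#) + (∑ᵐ d Φ₀ + Φtop)             ≈⟨ K.+-congˡ lower ⟨
      g (Vec.replicate (suc d) F.0#) + ∑ᵐ (suc d) Φ                 ∎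
      where
      d = toℕ k
      g₀ : Vec F.Carrier d → K.Carrier
      g₀ v = g (v ∷ʳ F.0#)
      Φ Φ₀ : (k : Fin d₀) → F* → Vec F.Carrier (toℕ k) → K.Carrier
      Φ  k ε c = g (scaledMonic (suc d) ε c)
      Φ₀ k ε c = g₀ (scaledMonic d ε c)
      Φtop : K.Carrier
      Φtop = ∑ F*-elements (λ ε → ∑ᵛ d (Φ k ε))
      top : ∑ F*-elements (λ ε → ∑ᵛ d (λ v → g (v ∷ʳ proj₁ ε))) ≈ Φtop
      top = ∑-cong F*-elements (λ ε → K.sym (K.trans
        (∑ᵛ-cong d (λ c → g-resp (Pointwise.trans F.trans
          (≡⇒≋ (≡.trans (≡.cong (Vec.map (proj₁ ε F.*_)) (pad-id (c ∷ʳ F.1#))) (map-∷ʳ (proj₁ ε F.*_) c F.1#)))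
          (∷ʳ-cong (≡⇒≋ (≡.sym (zipWith-scaleBy ε c))) (F.*-identityʳ _)))))
        (∑ᵛ-reindex d (Vec.replicate d (scaleBy ε)) (λ v → g (v ∷ʳ proj₁ ε)) (λ u≋v → g-resp (∷ʳ-cong u≋v F.refl)))))
      lower : ∑ᵐ (suc d) Φ ≈ ∑ᵐ d Φ₀ + Φtop
      lower = K.trans (∑-allFin-below-suc k (λ k′ → ∑ F*-elements (λ ε → ∑ᵛ (toℕ k′) (Φ k′ ε))))
        (K.+-congʳ (∑ᵐ-cong d (λ k′ k′<d ε c → g-resp (Pointwise.trans F.trans
          (≡⇒≋ (≡.trans (≡.cong (Vec.map (proj₁ ε F.*_)) (pad-suc d (c ∷ʳ F.1#) k′<d)) (map-∷ʳ (proj₁ ε F.*_) (pad d (c ∷ʳ F.1#)) F.0#)))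
          (∷ʳ-cong ≋-refl (F.zeroʳ _))))))

  ∑ᵛ-decomposition : ∀ d → d ≤ d₀ → Decomposition d
  ∑ᵛ-decomposition = induction-below d₀ Decomposition (λ g _ → K.+-congˡ (K.sym (∑-0 (List.allFin d₀)))) decomposition-step

  powerSum : Fin d₀ → ℕ → K.Carrier
  powerSum k s = ∑ᵛ (toℕ k) (λ c → inv k c ^ s)

  module _ (d : ℕ) where

    ∑ᵐ-+ : ∀ Φ Ψ → ∑ᵐ d (λ k ε c → Φ k ε c + Ψ k ε c) ≈ ∑ᵐ d Φ + ∑ᵐ d Ψ
    ∑ᵐ-+ Φ Ψ = K.trans (∑-cong (List.allFin d₀) (λ k → K.trans
      (if-cong (toℕ k <ᵇ d) (λ _ → K.trans (∑-cong F*-elements (λ ε → ∑-+ (tuples elems (toℕ k)) _ _)) (∑-+ F*-elements _ _)))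
      (if-+ (toℕ k <ᵇ d) _ _))) (∑-+ (List.allFin d₀) _ _)

    ∑ᵐ-*ˡ : ∀ x Φ → ∑ᵐ d (λ k ε c → x * Φ k ε c) ≈ x * ∑ᵐ d Φ
    ∑ᵐ-*ˡ x Φ = K.trans (∑-cong (List.allFin d₀) (λ k → K.trans
      (if-cong (toℕ k <ᵇ d) (λ _ → K.trans (∑-cong F*-elements (λ ε → ∑-*ˡ (tuples elems (toℕ k)) x _)) (∑-*ˡ F*-elements x _)))
      (if-* (toℕ k <ᵇ d) x _))) (∑-*ˡ (List.allFin d₀) x _)

    ∑ᵐ-swap : ∀ {a} {A : Set a} (xs : List A) (Φ : A → (k : Fin d₀) → F* → Vec F.Carrier (toℕ k) → K.Carrier) →
              ∑ xs (λ x → ∑ᵐ d (Φ x)) ≈ ∑ᵐ d (λ k ε c → ∑ xs (λ x → Φ x k ε c))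
    ∑ᵐ-swap xs Φ = K.trans (∑-swap xs (List.allFin d₀) _) (∑-cong (List.allFin d₀) (λ k → K.trans
      (∑-if xs (toℕ k <ᵇ d) _)
      (if-cong (toℕ k <ᵇ d) (λ _ → K.trans (∑-swap xs F*-elements _) (∑-cong F*-elements (λ ε → ∑-swap xs (tuples elems (toℕ k)) _))))))

    ∑ᵐ-separable : ∀ (X : F* → K.Carrier) (Y : (k : Fin d₀) → Vec F.Carrier (toℕ k) → K.Carrier) →
      ∑ᵐ d (λ k ε c → X ε * Y k c) ≈ ∑ F*-elements X * ∑ (List.allFin d₀) (λ k → if toℕ k <ᵇ d then ∑ᵛ (toℕ k) (Y k) else 0#)
    ∑ᵐ-separable X Y = K.trans (∑-cong (List.allFin d₀) (λ k → K.trans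
      (if-cong (toℕ k <ᵇ d) (λ _ → K.trans (∑-cong F*-elements (λ ε → ∑-*ˡ (tuples elems (toℕ k)) (X ε) (Y k))) (∑-*ʳ F*-elements _ X)))
      (if-* (toℕ k <ᵇ d) _ _))) (∑-*ˡ (List.allFin d₀) _ _)

module SettingArithmetic {c₁ ℓ₁ c₂ ℓ₂} (S : Setting c₁ ℓ₁ c₂ ℓ₂) where
  open Setting S
  open import Algebra.Properties.CommutativeSemiring.Exp K.commutativeSemiring using (_^_)
  open IntegerImage K using (fromℕ; fromℤ)

  natK≡fromℕ : ∀ n → natK n ≡ fromℕ n
  natK≡fromℕ zero    = ≡.refl
  natK≡fromℕ (suc n) = ≡.cong (K._+_ K.1#) (natK≡fromℕ n)

  intK≡fromℤ : ∀ x → intK x ≡ fromℤ x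
  intK≡fromℤ (ℤ.+ n)   = natK≡fromℕ n
  intK≡fromℤ -[1+ n ] = ≡.cong K.-_ (natK≡fromℕ (suc n))

  powK≡^ : ∀ x n → powK x n ≡ x ^ n
  powK≡^ x zero    = ≡.refl
  powK≡^ x (suc n) = ≡.cong (x K.*_) (powK≡^ x n)

module ChenFormula {c₁ ℓ₁ c₂ ℓ₂} (S : Setting c₁ ℓ₁ c₂ ℓ₂) where
  open Setting S
  open K using (_≈_; _+_; _*_; -_; _-_; 0#; 1#)
  open import Relation.Binary.Reasoning.Setoid K.setoid
  open import Algebra.Properties.CommutativeSemiring.Exp K.commutativeSemiring using (_^_; ^-congˡ; ^-homo-*; ^-distrib-*)
  open RingProperties K.ring using (-‿distribˡ-*)
  open import Data.Nat.Combinatorics using (_C_)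
  open import Data.Nat.Divisibility using (_∣_; _∣?_)
  open RingSums K
  open IntegerImage K
  open PartialFractionCoefficients
  open PartialFractions K
  open FiniteFieldUnits F-finite
  open UnitPowerSums S
  open Monics S
  open CoefficientSums S
  open SettingArithmetic S
  private module ι = RingMorphisms.IsRingMonomorphism ι-mono

  pf-unitPowerSum≈Δ : ∀ a b i → 1 ≤ a → 1 ≤ b → 1 ≤ i → i < a ℕ.+ b →
    (fromℤ (pf a b i) + fromℤ (pf b a i)) * unitPowerSum (a ℕ.+ b ∸ i) ≈ intK (Δ r a b i (a ℕ.+ b ∸ i))
  pf-unitPowerSum≈Δ a b i 1≤a 1≤b 1≤i i<a+b = K.trans (byDivisibility ((r ∸ 1) ∣? j)) (K.reflexive (≡.sym (intK≡fromℤ (Δ r a b i j))))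
    where
    j = a ℕ.+ b ∸ i
    binomials = sgn (a ∸ 1) ℤ.* ℤ.+ ((j ∸ 1) C (a ∸ 1)) ℤ.+ sgn (b ∸ 1) ℤ.* ℤ.+ ((j ∸ 1) C (b ∸ 1))
    byDivisibility : (∣j : Dec ((r ∸ 1) ∣ j)) → (fromℤ (pf a b i) + fromℤ (pf b a i)) * unitPowerSum j ≈ fromℤ (if does ∣j then binomials else ℤ.0ℤ)
    byDivisibility (yes r-1∣j) = begin
      (fromℤ (pf a b i) + fromℤ (pf b a i)) * unitPowerSum j ≈⟨ K.*-cong (K.sym (fromℤ-+ (pf a b i) (pf b a i))) (unitPowerSum-divisible j r-1∣j) ⟩
      fromℤ (pf a b i ℤ.+ pf b a i) * - 1#                   ≡⟨ ≡.cong (λ z → fromℤ z * - 1#) (pf-symmetricSum a b i 1≤a 1≤b 1≤i i<a+b) ⟩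
      fromℤ (ℤ.- binomials) * - 1#                           ≈⟨ K.*-congʳ (fromℤ-neg binomials) ⟩
      - fromℤ binomials * - 1#                               ≈⟨ solve 2 (λ x o → (:- x) :* (:- o) := x :* o) K.refl (fromℤ binomials) 1# ⟩
      fromℤ binomials * 1#                                   ≈⟨ K.*-identityʳ _ ⟩
      fromℤ binomials                                        ∎
      where open Solver
    byDivisibility (no r-1∤j) = K.trans (K.*-congˡ (unitPowerSum-indivisible j r-1∤j)) (K.zeroʳ _)

  module _ (k : Fin d₀) where
    private
      d = toℕ k

      U : Vec F.Carrier d → K.Carrier
      U = inv k

      U^-resp : ∀ s → Respects≋ (λ v → U v ^ s)
      U^-resp s u≋v = ^-congˡ s (inv-cong k u≋v)

      C D : (k′ : Fin d₀) → F* → Vec F.Carrier (toℕ k′) → K.Carrier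
      C k′ ε c = ι (ε ⁻¹) * inv k′ c
      D k′ ε c = ι (F.- ε ⁻¹) * inv k′ c

      D≈-C : ∀ k′ ε c → D k′ ε c ≈ - C k′ ε c
      D≈-C k′ ε c = K.trans (K.*-congʳ (ι.-‿homo (ε ⁻¹))) (K.sym (-‿distribˡ-* _ _))

      -- [A] - [A - δ] = [δ] = ε [M] for δ = ε M with M monic of degree k′ < d.
      C*[A-B]≈1 : ∀ k′ → toℕ k′ < d → ∀ ε c A → C k′ ε c * (⟦monic⟧ k A - ⟦monic⟧ k (A ⊖ scaledMonic d ε c)) ≈ 1#
      C*[A-B]≈1 k′ k′<d ε c A = begin
        C k′ ε c * (⟦monic⟧ k A - ⟦monic⟧ k (A ⊖ δ))           ≡⟨ ≡.cong₂ (λ x y → C k′ ε c * (x - y)) (⟦monic⟧≡ k A) (⟦monic⟧≡ k (A ⊖ δ)) ⟩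
        C k′ ε c * (⟦ A ∷ʳ F.1# ⟧ᵥ - ⟦ (A ⊖ δ) ∷ʳ F.1# ⟧ᵥ)     ≈⟨ K.*-congˡ (K.+-congˡ (K.-‿cong (⟦monic-⊖⟧ A δ))) ⟩
        C k′ ε c * (⟦ A ∷ʳ F.1# ⟧ᵥ - (⟦ A ∷ʳ F.1# ⟧ᵥ - ⟦ δ ⟧ᵥ)) ≈⟨ K.*-congˡ (solve 2 (λ m l → m :- (m :- l) := l) K.refl _ _) ⟩
        C k′ ε c * ⟦ δ ⟧ᵥ                                     ≈⟨ K.*-congˡ (⟦⟧ᵥ-scal (proj₁ ε) (pad d (c ∷ʳ F.1#))) ⟩
        C k′ ε c * (ι (proj₁ ε) * ⟦ pad d (c ∷ʳ F.1#) ⟧ᵥ)     ≈⟨ K.*-congˡ (K.*-congˡ (⟦⟧ᵥ-pad d (c ∷ʳ F.1#) k′<d)) ⟩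
        C k′ ε c * (ι (proj₁ ε) * ⟦ c ∷ʳ F.1# ⟧ᵥ)             ≡⟨ ≡.cong (λ x → C k′ ε c * (ι (proj₁ ε) * x)) (≡.sym (⟦monic⟧≡ k′ c)) ⟩
        (ι (ε ⁻¹) * inv k′ c) * (ι (proj₁ ε) * ⟦monic⟧ k′ c)
          ≈⟨ solve 4 (λ e′ v e m → (e′ :* v) :* (e :* m) := (e′ :* e) :* (m :* v)) K.refl (ι (ε ⁻¹)) (inv k′ c) (ι (proj₁ ε)) (⟦monic⟧ k′ c) ⟩
        (ι (ε ⁻¹) * ι (proj₁ ε)) * (⟦monic⟧ k′ c * inv k′ c)  ≈⟨ K.*-cong (K.sym (ι.*-homo (ε ⁻¹) (proj₁ ε))) (⟦monic⟧*inv≈1 k′ c) ⟩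
        ι (ε ⁻¹ F.* proj₁ ε) * 1#                             ≈⟨ K.trans (K.*-identityʳ _) (K.trans (ι.⟦⟧-cong (x⁻¹*x≈1 ε)) ι.1#-homo) ⟩
        1#                                                    ∎
        where
        open Solver
        δ = scaledMonic d ε c

      UA*UB≈C[UB-UA] : ∀ k′ → toℕ k′ < d → ∀ ε c A → U A * U (A ⊖ scaledMonic d ε c) ≈ C k′ ε c * (U (A ⊖ scaledMonic d ε c) - U A)
      UA*UB≈C[UB-UA] k′ k′<d ε c A = K.sym (begin
        C′ * (V - W)                         ≈⟨ K.*-congˡ (K.+-cong (K.trans (K.sym (K.*-identityʳ V)) (K.*-congˡ (K.sym (⟦monic⟧*inv≈1 k A))))
                                                                  (K.-‿cong (K.trans (K.sym (K.*-identityʳ W)) (K.*-congˡ (K.sym (⟦monic⟧*inv≈1 k B)))))) ⟩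
        C′ * (V * (Ma * W) - W * (Mb * V))    ≈⟨ solve 5 (λ c w v ma mb → c :* (v :* (ma :* w) :- w :* (mb :* v)) := (w :* v) :* (c :* (ma :- mb))) K.refl C′ W V Ma Mb ⟩
        (W * V) * (C′ * (Ma - Mb))            ≈⟨ K.*-congˡ (C*[A-B]≈1 k′ k′<d ε c A) ⟩
        (W * V) * 1#                          ≈⟨ K.*-identityʳ _ ⟩
        W * V                                 ∎)
        where
        open Solver
        B = A ⊖ scaledMonic d ε c
        W = U A
        V = U B
        C′ = C k′ ε c
        Ma = ⟦monic⟧ k A
        Mb = ⟦monic⟧ k B

      ∑ᵐ-power : ∀ (X : F* → K.Carrier) j → ∑ F*-elements (λ ε → X ε ^ j) ≈ unitPowerSum j →
                 ∑ᵐ d (λ k′ ε c → (X ε * inv k′ c) ^ j) ≈ unitPowerSum j * ℋ d (j ∷ [])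
      ∑ᵐ-power X j ∑Xʲ≈E = begin
        ∑ᵐ d (λ k′ ε c → (X ε * inv k′ c) ^ j)     ≈⟨ ∑ᵐ-cong d (λ k′ _ ε c → ^-distrib-* (X ε) (inv k′ c) j) ⟩
        ∑ᵐ d (λ k′ ε c → X ε ^ j * inv k′ c ^ j)  ≈⟨ ∑ᵐ-separable d (λ ε → X ε ^ j) (λ k′ c → inv k′ c ^ j) ⟩
        ∑ F*-elements (λ ε → X ε ^ j) * ∑ (List.allFin d₀) (λ k′ → if toℕ k′ <ᵇ d then ∑ᵛ (toℕ k′) (λ c → inv k′ c ^ j) else 0#)
          ≈⟨ K.*-cong ∑Xʲ≈E (∑-cong (List.allFin d₀) (λ k′ → if-cong (toℕ k′ <ᵇ d) (λ _ →
               ∑ᵛ-cong (toℕ k′) (λ c → K.sym (K.trans (K.*-identityʳ _) (K.reflexive (powK≡^ (inv k′ c) j))))))) ⟩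
        unitPowerSum j * ℋ d (j ∷ [])             ∎

    powerSum-product : ∀ a b → 1 ≤ a → 1 ≤ b →
      powerSum k a * powerSum k b ≈
      powerSum k (a ℕ.+ b) + ∑ (List.map suc (List.upTo (a ℕ.+ b ∸ 1)))
                                 (λ i → intK (Δ r a b i (a ℕ.+ b ∸ i)) * (powerSum k i * ℋ d (a ℕ.+ b ∸ i ∷ [])))
    powerSum-product a b 1≤a 1≤b = begin
      T a * T b                                                    ≈⟨ ∑-*ʳ As (T b) (λ A → U A ^ a) ⟨
      ∑ᵛ d (λ A → U A ^ a * T b)                                   ≈⟨ ∑-cong As fixedA ⟩
      ∑ᵛ d (λ A → U A ^ n + ∑ᵐ d (λ k′ ε c → ∑ Is (term A k′ ε c))) ≈⟨ ∑-+ As _ _ ⟩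
      T n + ∑ᵛ d (λ A → ∑ᵐ d (λ k′ ε c → ∑ Is (term A k′ ε c)))    ≈⟨ K.+-congˡ (∑ᵐ-swap d As (λ A k′ ε c → ∑ Is (term A k′ ε c))) ⟩
      T n + ∑ᵐ d (λ k′ ε c → ∑ᵛ d (λ A → ∑ Is (term A k′ ε c)))
        ≈⟨ K.+-congˡ (∑ᵐ-cong d (λ k′ _ ε c → K.trans (∑-swap As Is _) (∑-cong Is (summedOverA k′ ε c)))) ⟩
      T n + ∑ᵐ d (λ k′ ε c → ∑ Is (term′ k′ ε c))                  ≈⟨ K.+-congˡ (∑ᵐ-swap d Is (λ i k′ ε c → term′ k′ ε c i)) ⟨
      T n + ∑ Is (λ i → ∑ᵐ d (λ k′ ε c → term′ k′ ε c i))          ≈⟨ K.+-congˡ (∑-cong Is summedOverδ) ⟩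
      T n + ∑ Is W                                                 ≈⟨ K.+-congˡ (∑-upTo-interior n W _ 1≤n W0≈0 Wn≈0
                                                                        (λ i 1≤i i<n → K.*-congʳ (pf-unitPowerSum≈Δ a b i 1≤a 1≤b 1≤i i<n))) ⟩
      T n + ∑ (List.map suc (List.upTo (n ∸ 1))) (λ i → intK (Δ r a b i (n ∸ i)) * (T i * ℋ d (n ∸ i ∷ []))) ∎
      where
      T = powerSum k
      n = a ℕ.+ b
      Is = List.upTo (suc n)
      As = tuples (IsFiniteField.elems F-finite) d
      1≤n : 1 ≤ n
      1≤n = ℕP.≤-trans 1≤a (ℕP.m≤m+n a b)

      term : Vec F.Carrier d → (k′ : Fin d₀) → F* → Vec F.Carrier (toℕ k′) → ℕ → K.Carrier
      term A k′ ε c = pfTerm (U A) (U (A ⊖ scaledMonic d ε c)) (C k′ ε c) (D k′ ε c) a b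

      term′ : (k′ : Fin d₀) → F* → Vec F.Carrier (toℕ k′) → ℕ → K.Carrier
      term′ k′ ε c i = fromℤ (pf a b i) * (T i * C k′ ε c ^ (n ∸ i)) + fromℤ (pf b a i) * (T i * D k′ ε c ^ (n ∸ i))

      W : ℕ → K.Carrier
      W i = ((fromℤ (pf a b i) + fromℤ (pf b a i)) * unitPowerSum (n ∸ i)) * (T i * ℋ d (n ∸ i ∷ []))

      -- For fixed A the monic B runs over A - δ with δ of degree < d; δ = 0 gives the diagonal term.
      fixedA : ∀ A → U A ^ a * T b ≈ U A ^ n + ∑ᵐ d (λ k′ ε c → ∑ Is (term A k′ ε c))
      fixedA A = begin
        U A ^ a * T b                   ≈⟨ K.*-congˡ (∑ᵛ-reindex d (Vec.map reflect A) (λ v → U v ^ b) (U^-resp b)) ⟨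
        U A ^ a * ∑ᵛ d (λ δ → U (zipWith Inverse.to (Vec.map reflect A) δ) ^ b)
          ≈⟨ K.*-congˡ (∑ᵛ-cong d (λ δ → K.reflexive (≡.cong (λ v → U v ^ b) (zipWith-reflect A δ)))) ⟩
        U A ^ a * ∑ᵛ d g                ≈⟨ K.*-congˡ (∑ᵛ-decomposition d (ℕP.<⇒≤ (FinP.toℕ<n k)) g (λ u≋v → U^-resp b (⊖-cong ≋-refl u≋v))) ⟩
        U A ^ a * (g (Vec.replicate d F.0#) + ∑ᵐ d (λ k′ ε c → g (scaledMonic d ε c)))  ≈⟨ K.distribˡ _ _ _ ⟩
        U A ^ a * g (Vec.replicate d F.0#) + U A ^ a * ∑ᵐ d (λ k′ ε c → g (scaledMonic d ε c))
          ≈⟨ K.+-cong (K.trans (K.*-congˡ (U^-resp b (⊖-zero A))) (K.sym (^-homo-* (U A) a b))) (K.sym (∑ᵐ-*ˡ d _ _)) ⟩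
        U A ^ n + ∑ᵐ d (λ k′ ε c → U A ^ a * g (scaledMonic d ε c))
          ≈⟨ K.+-congˡ (∑ᵐ-cong d (λ k′ k′<d ε c → partialFractions (UA*UB≈C[UB-UA] k′ k′<d ε c A) (D≈-C k′ ε c) a b n 1≤n ℕP.≤-refl)) ⟩
        U A ^ n + ∑ᵐ d (λ k′ ε c → ∑ Is (term A k′ ε c)) ∎
        where
        g : Vec F.Carrier d → K.Carrier
        g δ = U (A ⊖ δ) ^ b
        zipWith-reflect : ∀ {m} (A δ : Vec F.Carrier m) → zipWith Inverse.to (Vec.map reflect A) δ ≡ A ⊖ δ
        zipWith-reflect []      []      = ≡.refl
        zipWith-reflect (x ∷ A) (y ∷ δ) = ≡.cong (_ ∷_) (zipWith-reflect A δ)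

      summedOverA : ∀ k′ ε c i → ∑ᵛ d (λ A → term A k′ ε c i) ≈ term′ k′ ε c i
      summedOverA k′ ε c i = begin
        ∑ᵛ d (λ A → term A k′ ε c i)                                          ≈⟨ ∑-+ As _ _ ⟩
        ∑ᵛ d (λ A → x₁ * (U A ^ i * Cʲ)) + ∑ᵛ d (λ A → x₂ * (U (A ⊖ δ) ^ i * Dʲ))
          ≈⟨ K.+-cong (K.trans (∑-*ˡ As x₁ _) (K.*-congˡ (∑-*ʳ As Cʲ _)))
                      (K.trans (∑-*ˡ As x₂ _) (K.*-congˡ (K.trans (∑-*ʳ As Dʲ _) (K.*-congʳ shifted)))) ⟩
        term′ k′ ε c i                                                        ∎
        where
        δ = scaledMonic d ε c
        x₁ = fromℤ (pf a b i)
        x₂ = fromℤ (pf b a i)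
        Cʲ = C k′ ε c ^ (n ∸ i)
        Dʲ = D k′ ε c ^ (n ∸ i)
        zipWith-translate : ∀ {m} (δ A : Vec F.Carrier m) → zipWith Inverse.to (Vec.map translate δ) A ≡ A ⊖ δ
        zipWith-translate []      []      = ≡.refl
        zipWith-translate (x ∷ δ) (y ∷ A) = ≡.cong (_ ∷_) (zipWith-translate δ A)
        shifted : ∑ᵛ d (λ A → U (A ⊖ δ) ^ i) ≈ T i
        shifted = K.trans (∑ᵛ-cong d (λ A → K.reflexive (≡.cong (λ v → U v ^ i) (≡.sym (zipWith-translate δ A)))))
                          (∑ᵛ-reindex d (Vec.map translate δ) (λ v → U v ^ i) (U^-resp i))

      summedOverδ : ∀ i → ∑ᵐ d (λ k′ ε c → term′ k′ ε c i) ≈ W i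
      summedOverδ i = begin
        ∑ᵐ d (λ k′ ε c → term′ k′ ε c i)                                               ≈⟨ ∑ᵐ-+ d _ _ ⟩
        ∑ᵐ d (λ k′ ε c → x₁ * (T i * C k′ ε c ^ j)) + ∑ᵐ d (λ k′ ε c → x₂ * (T i * D k′ ε c ^ j))
          ≈⟨ K.+-cong (K.trans (∑ᵐ-*ˡ d x₁ _) (K.*-congˡ (K.trans (∑ᵐ-*ˡ d (T i) _) (K.*-congˡ (∑ᵐ-power (λ ε → ι (ε ⁻¹)) j (unitPowerSum-inverse j))))))
                      (K.trans (∑ᵐ-*ˡ d x₂ _) (K.*-congˡ (K.trans (∑ᵐ-*ˡ d (T i) _) (K.*-congˡ (∑ᵐ-power (λ ε → ι (F.- ε ⁻¹)) j (unitPowerSum-negatedInverse j)))))) ⟩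
        x₁ * (T i * (unitPowerSum j * ℋ d (j ∷ []))) + x₂ * (T i * (unitPowerSum j * ℋ d (j ∷ [])))
          ≈⟨ solve 5 (λ x₁ x₂ t e h → x₁ :* (t :* (e :* h)) :+ x₂ :* (t :* (e :* h)) := ((x₁ :+ x₂) :* e) :* (t :* h))
                   K.refl x₁ x₂ (T i) (unitPowerSum j) (ℋ d (j ∷ [])) ⟩
        W i                                                                            ∎
        where
        open Solver
        j = n ∸ i
        x₁ = fromℤ (pf a b i)
        x₂ = fromℤ (pf b a i)

      vanishing : ∀ i → pf a b i ≡ ℤ.0ℤ → pf b a i ≡ ℤ.0ℤ → W i ≈ 0#
      vanishing i pf₁≡0 pf₂≡0 = begin
        W i                                     ≡⟨ ≡.cong₂ (λ x y → ((fromℤ x + fromℤ y) * E) * R) pf₁≡0 pf₂≡0 ⟩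
        ((0# + 0#) * E) * R                     ≈⟨ K.*-congʳ (K.trans (K.*-congʳ (K.+-identityˡ 0#)) (K.zeroˡ E)) ⟩
        0# * R                                  ≈⟨ K.zeroˡ R ⟩
        0#                                      ∎
        where
        E = unitPowerSum (n ∸ i)
        R = T i * ℋ d (n ∸ i ∷ [])

      W0≈0 : W 0 ≈ 0#
      W0≈0 = vanishing 0 (pf-at-0 a b 1≤n) (pf-at-0 b a (ℕP.≤-trans 1≤n (ℕP.≤-reflexive (ℕP.+-comm a b))))

      Wn≈0 : W n ≈ 0#
      Wn≈0 = vanishing n (pf-vanishes a b n (ℕP.≤-trans (ℕP.≤-reflexive (ℕP.+-comm 1 a)) (ℕP.+-monoʳ-≤ a 1≤b)))
                       (pf-vanishes b a n (ℕP.+-monoˡ-≤ b 1≤a))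

module HarmonicSums {c₁ ℓ₁ c₂ ℓ₂} (S : Setting c₁ ℓ₁ c₂ ℓ₂) where
  open Setting S
  open K using (_≈_; _+_; _*_; -_; _-_; 0#; 1#)
  open import Relation.Binary.Reasoning.Setoid K.setoid
  open RingSums K
  open IntegerImage K using (fromℤ-*; module Solver)
  open CoefficientSums S using (powerSum)
  open SettingArithmetic S

  ℋ-suc : ∀ (k : Fin d₀) s ss → ℋ (suc (toℕ k)) (s ∷ ss) ≈ ℋ (toℕ k) (s ∷ ss) + powerSum k s * ℋ (toℕ k) ss
  ℋ-suc k s ss = K.trans (∑-allFin-below-suc k _) (K.+-congˡ (begin
    ∑ (tuples (IsFiniteField.elems F-finite) (toℕ k)) (λ c → powK (inv k c) s * ℋ (toℕ k) ss)
      ≈⟨ ∑-cong (tuples (IsFiniteField.elems F-finite) (toℕ k)) (λ c → K.*-congʳ (K.reflexive (powK≡^ (inv k c) s))) ⟩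
    ∑ (tuples (IsFiniteField.elems F-finite) (toℕ k)) (λ c → _ * ℋ (toℕ k) ss)
      ≈⟨ ∑-*ʳ (tuples (IsFiniteField.elems F-finite) (toℕ k)) (ℋ (toℕ k) ss) _ ⟩
    powerSum k s * ℋ (toℕ k) ss ∎))

  ℋ-0 : ∀ s ss → ℋ 0 (s ∷ ss) ≈ 0#
  ℋ-0 s ss = ∑-0 (List.allFin d₀)

  intK-* : ∀ x y → intK (x ℤ.* y) ≈ intK x * intK y
  intK-* x y = K.trans (K.reflexive (intK≡fromℤ (x ℤ.* y)))
    (K.trans (fromℤ-* x y) (K.reflexive (≡.sym (≡.cong₂ _*_ (intK≡fromℤ x) (intK≡fromℤ y)))))

  ℋ̂-++ : ∀ d f g → ℋ̂ d (f ++ g) ≈ ℋ̂ d f + ℋ̂ d g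
  ℋ̂-++ d f g = ∑-++ f g _

  ℋ̂-single : ∀ d w → ℋ̂ d (single w) ≈ ℋ d w
  ℋ̂-single d w = K.trans (K.+-identityʳ _) (K.trans (K.*-congʳ (K.+-identityʳ _)) (K.*-identityˡ _))

  ℋ̂-scale : ∀ d x f → ℋ̂ d (scale x f) ≈ intK x * ℋ̂ d f
  ℋ̂-scale d x f = begin
    ℋ̂ d (scale x f)                                    ≡⟨ ∑-map f _ _ ⟩
    ∑ f (λ (y , w) → intK (x ℤ.* y) * ℋ d w)            ≈⟨ ∑-cong f (λ (y , w) → K.trans (K.*-congʳ (intK-* x y)) (K.*-assoc _ _ _)) ⟩
    ∑ f (λ (y , w) → intK x * (intK y * ℋ d w))         ≈⟨ ∑-*ˡ f (intK x) _ ⟩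
    intK x * ℋ̂ d f                                     ∎

  ℋ̂-concatMap : ∀ {a} {A : Set a} d (h : A → Formal) xs → ℋ̂ d (List.concatMap h xs) ≈ ∑ xs (λ x → ℋ̂ d (h x))
  ℋ̂-concatMap d h xs = ∑-concatMap xs h _

  ℋ̂-extL : ∀ d m f w → ℋ̂ d (extL m f w) ≈ ∑ f (λ (x , u) → intK x * ℋ̂ d (m u w))
  ℋ̂-extL d m f w = K.trans (ℋ̂-concatMap d _ f) (∑-cong f (λ (x , u) → ℋ̂-scale d x (m u w)))

  ℋ̂-prefix-suc : ∀ (k : Fin d₀) s f → ℋ̂ (suc (toℕ k)) (prefix s f) ≈ ℋ̂ (toℕ k) (prefix s f) + powerSum k s * ℋ̂ (toℕ k) f
  ℋ̂-prefix-suc k s f = begin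
    ℋ̂ (suc d) (prefix s f)                                                   ≡⟨ ∑-map f _ _ ⟩
    ∑ f (λ (x , w) → intK x * ℋ (suc d) (s ∷ w))                             ≈⟨ ∑-cong f (λ (x , w) → K.trans (K.*-congˡ (ℋ-suc k s w))
                                                                                  (solve 4 (λ x h t h′ → x :* (h :+ t :* h′) := x :* h :+ t :* (x :* h′)) K.refl _ _ _ _)) ⟩
    ∑ f (λ (x , w) → intK x * ℋ d (s ∷ w) + powerSum k s * (intK x * ℋ d w)) ≈⟨ ∑-+ f _ _ ⟩
    ∑ f (λ (x , w) → intK x * ℋ d (s ∷ w)) + ∑ f (λ (x , w) → powerSum k s * (intK x * ℋ d w))
                                                                             ≈⟨ K.+-cong (K.reflexive (≡.sym (∑-map f _ _))) (∑-*ˡ f _ _) ⟩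
    ℋ̂ d (prefix s f) + powerSum k s * ℋ̂ d f                                  ∎
    where
    open Solver
    d = toℕ k

  ℋ̂-prefix-0 : ∀ s f → ℋ̂ 0 (prefix s f) ≈ 0#
  ℋ̂-prefix-0 s f = begin
    ℋ̂ 0 (prefix s f)                          ≡⟨ ∑-map f _ _ ⟩
    ∑ f (λ (x , w) → intK x * ℋ 0 (s ∷ w))    ≈⟨ ∑-cong f (λ (x , w) → K.trans (K.*-congˡ (ℋ-0 s w)) (K.zeroʳ _)) ⟩
    ∑ f (λ _ → 0#)                            ≈⟨ ∑-0 f ⟩
    0#                                        ∎

module ShuffleWords where
  open import Data.Product using (_×_)

  Positive : Word → Set
  Positive = All (1 ≤_)

  Admissible : ℕ → Formal → Set
  Admissible m = All (λ (_ , w) → Positive w × length w ≤ m)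

  private
    admissible-mono : ∀ {m m′ f} → m ≤ m′ → Admissible m f → Admissible m′ f
    admissible-mono m≤m′ = All.map (λ (pw , |w|≤m) → pw , ℕP.≤-trans |w|≤m m≤m′)

    admissible-prefix : ∀ {m k f} → 1 ≤ k → Admissible m f → Admissible (suc m) (prefix k f)
    admissible-prefix 1≤k adm = AllP.map⁺ (All.map (λ (pw , |w|≤m) → (1≤k ∷ pw) , s≤s |w|≤m) adm)

    admissible-scale : ∀ {m f} x → Admissible m f → Admissible m (scale x f)
    admissible-scale x adm = AllP.map⁺ adm

    admissible-concatMap : ∀ {a} {A : Set a} {m} {h : A → Formal} {xs} → All (λ x → Admissible m (h x)) xs → Admissible m (List.concatMap h xs)
    admissible-concatMap adm = AllP.concat⁺ (AllP.map⁺ adm)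

  inner-indices : ∀ {p} {P : ℕ → Set p} a b → (∀ i → 1 ≤ i → i < a ℕ.+ b → P i) → All P (List.map suc (List.upTo (a ℕ.+ b ∸ 1)))
  inner-indices a b h = AllP.map⁺ (AllP.applyUpTo⁺₁ (λ i → i) (a ℕ.+ b ∸ 1) (λ {i} i< → h (suc i) (s≤s z≤n) (suc-< i (a ℕ.+ b) i<)))
    where
    suc-< : ∀ i n → i < n ∸ 1 → suc i < n
    suc-< i (suc n) i<n = s≤s i<n

  star-admissible : ∀ {r} n u v → Positive u → Positive v → Admissible (length u ℕ.+ length v) (star r n u v)
  star-admissible n       []       v        _   pv = (pv , ℕP.≤-refl) ∷ []
  star-admissible n       (a ∷ as) []       pu  _  = (pu , ℕP.m≤m+n (length (a ∷ as)) 0) ∷ []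
  star-admissible zero    (a ∷ as) (b ∷ bs) _   _  = []
  star-admissible {r} (suc n) (a ∷ as) (b ∷ bs) (pa ∷ pas) (pb ∷ pbs) =
    AllP.++⁺ adm₁ (AllP.++⁺ adm₂ (AllP.++⁺ adm₃ adm₄))
    where
    m≡ : suc (suc (length as ℕ.+ length bs)) ≡ suc (length as ℕ.+ suc (length bs))
    m≡ = ≡.cong suc (≡.sym (ℕP.+-suc (length as) (length bs)))
    adm₁ = admissible-prefix pa (star-admissible n as (b ∷ bs) pas (pb ∷ pbs))
    adm₂ = admissible-mono (ℕP.≤-reflexive m≡) (admissible-prefix pb (star-admissible n (a ∷ as) bs (pa ∷ pas) pbs))
    adm₃ = admissible-mono (ℕP.≤-trans (ℕP.n≤1+n _) (ℕP.≤-reflexive m≡))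
             (admissible-prefix (ℕP.≤-trans pa (ℕP.m≤m+n a b)) (star-admissible n as bs pas pbs))
    adm₄ = admissible-concatMap (inner-indices a b (λ i 1≤i i<a+b →
             admissible-scale (Δ r a b i (a ℕ.+ b ∸ i)) (admissible-mono (ℕP.≤-reflexive m≡) (admissible-prefix 1≤i
               (admissible-concatMap (All.map (λ {(x , w)} (pw , |w|≤) →
                  admissible-scale x (admissible-mono (ℕP.≤-trans (ℕP.≤-reflexive (ℕP.+-comm (length w) 1)) (s≤s |w|≤))
                    (star-admissible n w (a ℕ.+ b ∸ i ∷ []) pw (ℕP.m<n⇒0<n∸m i<a+b ∷ [])))) (star-admissible n as bs pas pbs)))))))

module ProductFormula {c₁ ℓ₁ c₂ ℓ₂} (S : Setting c₁ ℓ₁ c₂ ℓ₂) where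
  open Setting S
  open K using (_≈_; _+_; _*_; -_; _-_; 0#; 1#)
  open import Relation.Binary.Reasoning.Setoid K.setoid
  open RingSums K
  open IntegerImage K using (module Solver)
  open CoefficientSums S using (powerSum)
  open ChenFormula S using (powerSum-product)
  open HarmonicSums S
  open ShuffleWords

  module StarUnfolding (n a b : ℕ) (as bs : Word) where
    Y₁ Y₂ Y₃ : Formal
    Y₁ = star r n as (b ∷ bs)
    Y₂ = star r n (a ∷ as) bs
    Y₃ = star r n as bs

    inner : List ℕ
    inner = List.map suc (List.upTo (a ℕ.+ b ∸ 1))

    Δ′ : ℕ → ℤ
    Δ′ i = Δ r a b i (a ℕ.+ b ∸ i)

    Z : ℕ → Formal
    Z i = extL (star r n) Y₃ (a ℕ.+ b ∸ i ∷ [])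

    X₄ : Formal
    X₄ = List.concatMap (λ i → scale (Δ′ i) (prefix i (Z i))) inner

    ℋ̂-star : ∀ d → ℋ̂ d (star r (suc n) (a ∷ as) (b ∷ bs)) ≈ ℋ̂ d (prefix a Y₁) + (ℋ̂ d (prefix b Y₂) + (ℋ̂ d (prefix (a ℕ.+ b) Y₃) + ℋ̂ d X₄))
    ℋ̂-star d = K.trans (ℋ̂-++ d (prefix a Y₁) _) (K.+-congˡ (K.trans (ℋ̂-++ d (prefix b Y₂) _) (K.+-congˡ (ℋ̂-++ d (prefix (a ℕ.+ b) Y₃) X₄))))

    ℋ̂-X₄ : ∀ d → ℋ̂ d X₄ ≈ ∑ inner (λ i → intK (Δ′ i) * ℋ̂ d (prefix i (Z i)))
    ℋ̂-X₄ d = K.trans (ℋ̂-concatMap d _ inner) (∑-cong inner (λ i → ℋ̂-scale d (Δ′ i) (prefix i (Z i))))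

    ℋ̂-star-suc : ∀ (k : Fin d₀) → let d = toℕ k; T = powerSum k in
      ℋ̂ (suc d) (star r (suc n) (a ∷ as) (b ∷ bs)) ≈
      ℋ̂ d (star r (suc n) (a ∷ as) (b ∷ bs)) +
        (T a * ℋ̂ d Y₁ + (T b * ℋ̂ d Y₂ + (T (a ℕ.+ b) * ℋ̂ d Y₃ + ∑ inner (λ i → intK (Δ′ i) * (T i * ℋ̂ d (Z i))))))
    ℋ̂-star-suc k = begin
      ℋ̂ (suc d) (star r (suc n) (a ∷ as) (b ∷ bs))
        ≈⟨ ℋ̂-star (suc d) ⟩
      ℋ̂ (suc d) (prefix a Y₁) + (ℋ̂ (suc d) (prefix b Y₂) + (ℋ̂ (suc d) (prefix (a ℕ.+ b) Y₃) + ℋ̂ (suc d) X₄))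
        ≈⟨ K.+-cong (ℋ̂-prefix-suc k a Y₁) (K.+-cong (ℋ̂-prefix-suc k b Y₂) (K.+-cong (ℋ̂-prefix-suc k (a ℕ.+ b) Y₃) X₄-suc)) ⟩
      (P₁ + T a * ℋ̂ d Y₁) + ((P₂ + T b * ℋ̂ d Y₂) + ((P₃ + T (a ℕ.+ b) * ℋ̂ d Y₃) + (P₄ + S₄)))
        ≈⟨ solve 8 (λ p₁ p₂ p₃ p₄ q₁ q₂ q₃ s₄ →
                    (p₁ :+ q₁) :+ ((p₂ :+ q₂) :+ ((p₃ :+ q₃) :+ (p₄ :+ s₄)))
                    := (p₁ :+ (p₂ :+ (p₃ :+ p₄))) :+ (q₁ :+ (q₂ :+ (q₃ :+ s₄))))
                 K.refl P₁ P₂ P₃ P₄ (T a * ℋ̂ d Y₁) (T b * ℋ̂ d Y₂) (T (a ℕ.+ b) * ℋ̂ d Y₃) S₄ ⟩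
      (P₁ + (P₂ + (P₃ + P₄))) + (T a * ℋ̂ d Y₁ + (T b * ℋ̂ d Y₂ + (T (a ℕ.+ b) * ℋ̂ d Y₃ + S₄)))
        ≈⟨ K.+-congʳ (K.sym (ℋ̂-star d)) ⟩
      ℋ̂ d (star r (suc n) (a ∷ as) (b ∷ bs)) + (T a * ℋ̂ d Y₁ + (T b * ℋ̂ d Y₂ + (T (a ℕ.+ b) * ℋ̂ d Y₃ + S₄))) ∎
      where
      open Solver
      d = toℕ k
      T = powerSum k
      P₁ = ℋ̂ d (prefix a Y₁)
      P₂ = ℋ̂ d (prefix b Y₂)
      P₃ = ℋ̂ d (prefix (a ℕ.+ b) Y₃)
      P₄ = ℋ̂ d X₄
      S₄ = ∑ inner (λ i → intK (Δ′ i) * (T i * ℋ̂ d (Z i)))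
      X₄-suc : ℋ̂ (suc d) X₄ ≈ P₄ + S₄
      X₄-suc = begin
        ℋ̂ (suc d) X₄                                                    ≈⟨ ℋ̂-X₄ (suc d) ⟩
        ∑ inner (λ i → intK (Δ′ i) * ℋ̂ (suc d) (prefix i (Z i)))       ≈⟨ ∑-cong inner (λ i → K.trans (K.*-congˡ (ℋ̂-prefix-suc k i (Z i))) (K.distribˡ _ _ _)) ⟩
        ∑ inner (λ i → intK (Δ′ i) * ℋ̂ d (prefix i (Z i)) + intK (Δ′ i) * (T i * ℋ̂ d (Z i))) ≈⟨ ∑-+ inner _ _ ⟩
        ∑ inner (λ i → intK (Δ′ i) * ℋ̂ d (prefix i (Z i))) + S₄          ≈⟨ K.+-congʳ (ℋ̂-X₄ d) ⟨
        P₄ + S₄                                                         ∎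

  ProductFormula : ℕ → Set ℓ₂
  ProductFormula d = ∀ n u v → Positive u → Positive v → length u ℕ.+ length v ≤ n → ℋ̂ d (star r n u v) ≈ ℋ d u * ℋ d v

  private
    product-0 : ProductFormula 0
    product-0 n       []       v        _ _ _  = K.trans (ℋ̂-single 0 v) (K.sym (K.*-identityˡ _))
    product-0 n       (a ∷ as) []       _ _ _  = K.trans (ℋ̂-single 0 (a ∷ as)) (K.sym (K.*-identityʳ _))
    product-0 zero    (a ∷ as) (b ∷ bs) _ _ ()
    product-0 (suc n) (a ∷ as) (b ∷ bs) _ _ _  = begin
      ℋ̂ 0 (star r (suc n) (a ∷ as) (b ∷ bs))
        ≈⟨ ℋ̂-star 0 ⟩
      ℋ̂ 0 (prefix a Y₁) + (ℋ̂ 0 (prefix b Y₂) + (ℋ̂ 0 (prefix (a ℕ.+ b) Y₃) + ℋ̂ 0 X₄))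
        ≈⟨ K.+-cong (ℋ̂-prefix-0 a Y₁) (K.+-cong (ℋ̂-prefix-0 b Y₂) (K.+-cong (ℋ̂-prefix-0 (a ℕ.+ b) Y₃) X₄≈0)) ⟩
      0# + (0# + (0# + 0#))      ≈⟨ K.trans (K.+-identityˡ _) (K.trans (K.+-identityˡ _) (K.+-identityˡ _)) ⟩
      0#                         ≈⟨ K.zeroˡ _ ⟨
      0# * ℋ 0 (b ∷ bs)          ≈⟨ K.*-congʳ (ℋ-0 a as) ⟨
      ℋ 0 (a ∷ as) * ℋ 0 (b ∷ bs) ∎
      where
      open StarUnfolding n a b as bs
      X₄≈0 : ℋ̂ 0 X₄ ≈ 0#
      X₄≈0 = K.trans (ℋ̂-X₄ 0) (K.trans (∑-cong inner (λ i → K.trans (K.*-congˡ (ℋ̂-prefix-0 i (Z i))) (K.zeroʳ _))) (∑-0 inner))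

    product-suc : (k : Fin d₀) → ProductFormula (toℕ k) → ProductFormula (suc (toℕ k))
    product-suc k IH n       []       v        _ _ _ = K.trans (ℋ̂-single (suc (toℕ k)) v) (K.sym (K.*-identityˡ _))
    product-suc k IH n       (a ∷ as) []       _ _ _ = K.trans (ℋ̂-single (suc (toℕ k)) (a ∷ as)) (K.sym (K.*-identityʳ _))
    product-suc k IH zero    (a ∷ as) (b ∷ bs) _ _ ()
    product-suc k IH (suc n) (a ∷ as) (b ∷ bs) (pa ∷ pas) (pb ∷ pbs) (s≤s |as|+|b∷bs|≤n) = begin
      ℋ̂ (suc d) (star r (suc n) (a ∷ as) (b ∷ bs))
        ≈⟨ ℋ̂-star-suc k ⟩
      ℋ̂ d (star r (suc n) (a ∷ as) (b ∷ bs)) + (T a * ℋ̂ d Y₁ + (T b * ℋ̂ d Y₂ + (T (a ℕ.+ b) * ℋ̂ d Y₃ + S₄)))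
        ≈⟨ K.+-cong (IH (suc n) (a ∷ as) (b ∷ bs) (pa ∷ pas) (pb ∷ pbs) (s≤s |as|+|b∷bs|≤n))
                    (K.+-cong (K.*-congˡ (IH n as (b ∷ bs) pas (pb ∷ pbs) |as|+|b∷bs|≤n))
                    (K.+-cong (K.*-congˡ (IH n (a ∷ as) bs (pa ∷ pas) pbs |a∷as|+|bs|≤n))
                    (K.+-cong (K.*-congˡ (IH n as bs pas pbs |as|+|bs|≤n)) S₄≈))) ⟩
      Hu * Hv + (T a * (Has * Hv) + (T b * (Hu * Hbs) + (T (a ℕ.+ b) * (Has * Hbs) + SΔ * (Has * Hbs))))
        ≈⟨ K.+-congˡ (K.+-congˡ (K.+-congˡ (K.trans (K.sym (K.distribʳ _ _ _)) (K.*-congʳ (K.sym (powerSum-product k a b pa pb)))))) ⟩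
      Hu * Hv + (T a * (Has * Hv) + (T b * (Hu * Hbs) + (T a * T b) * (Has * Hbs)))
        ≈⟨ solve 6 (λ hu hv has hbs ta tb →
             hu :* hv :+ (ta :* (has :* hv) :+ (tb :* (hu :* hbs) :+ (ta :* tb) :* (has :* hbs)))
             := (hu :+ ta :* has) :* (hv :+ tb :* hbs)) K.refl Hu Hv Has Hbs (T a) (T b) ⟩
      (Hu + T a * Has) * (Hv + T b * Hbs)
        ≈⟨ K.*-cong (ℋ-suc k a as) (ℋ-suc k b bs) ⟨
      ℋ (suc d) (a ∷ as) * ℋ (suc d) (b ∷ bs) ∎
      where
      open StarUnfolding n a b as bs
      open Solver
      d = toℕ k
      T = powerSum k
      Hu = ℋ d (a ∷ as)
      Hv = ℋ d (b ∷ bs)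
      Has = ℋ d as
      Hbs = ℋ d bs
      S₄ = ∑ inner (λ i → intK (Δ′ i) * (T i * ℋ̂ d (Z i)))
      SΔ = ∑ inner (λ i → intK (Δ′ i) * (T i * ℋ d (a ℕ.+ b ∸ i ∷ [])))
      |a∷as|+|bs|≤n : suc (length as) ℕ.+ length bs ≤ n
      |a∷as|+|bs|≤n = ℕP.≤-trans (ℕP.≤-reflexive (≡.sym (ℕP.+-suc (length as) (length bs)))) |as|+|b∷bs|≤n
      |as|+|bs|≤n : length as ℕ.+ length bs ≤ n
      |as|+|bs|≤n = ℕP.≤-trans (ℕP.n≤1+n _) |a∷as|+|bs|≤n
      ℋ̂-Z : ∀ i → 1 ≤ i → i < a ℕ.+ b → ℋ̂ d (Z i) ≈ (Has * Hbs) * ℋ d (a ℕ.+ b ∸ i ∷ [])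
      ℋ̂-Z i 1≤i i<a+b = begin
        ℋ̂ d (Z i)                                               ≈⟨ ℋ̂-extL d (star r n) Y₃ (j ∷ []) ⟩
        ∑ Y₃ (λ (x , w) → intK x * ℋ̂ d (star r n w (j ∷ [])))
          ≈⟨ ∑-cong-All (star-admissible n as bs pas pbs) (λ {(x , w)} (pw , |w|≤) →
               K.trans (K.*-congˡ (IH n w (j ∷ []) pw (ℕP.m<n⇒0<n∸m i<a+b ∷ []) (|w|+1≤n {w} |w|≤))) (K.sym (K.*-assoc _ _ _))) ⟩
        ∑ Y₃ (λ (x , w) → (intK x * ℋ d w) * ℋ d (j ∷ []))      ≈⟨ ∑-*ʳ Y₃ _ _ ⟩
        ℋ̂ d Y₃ * ℋ d (j ∷ [])                                   ≈⟨ K.*-congʳ (IH n as bs pas pbs |as|+|bs|≤n) ⟩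
        (Has * Hbs) * ℋ d (j ∷ [])                              ∎
        where
        j = a ℕ.+ b ∸ i
        |w|+1≤n : ∀ {w : Word} → length w ≤ length as ℕ.+ length bs → length w ℕ.+ 1 ≤ n
        |w|+1≤n {w} |w|≤ = ℕP.≤-trans (ℕP.≤-reflexive (ℕP.+-comm (length w) 1))
                             (ℕP.≤-trans (s≤s |w|≤) (ℕP.≤-trans (ℕP.≤-reflexive (≡.sym (ℕP.+-suc (length as) (length bs)))) |as|+|b∷bs|≤n))
      S₄≈ : S₄ ≈ SΔ * (Has * Hbs)
      S₄≈ = begin
        S₄ ≈⟨ ∑-cong-All (inner-indices a b (λ i 1≤i i<a+b → 1≤i , i<a+b)) (λ {i} (1≤i , i<a+b) →
                K.trans (K.*-congˡ (K.*-congˡ (ℋ̂-Z i 1≤i i<a+b)))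
                  (solve 5 (λ x t h₁ h₂ h → x :* (t :* ((h₁ :* h₂) :* h)) := (x :* (t :* h)) :* (h₁ :* h₂)) K.refl
                    (intK (Δ′ i)) (T i) Has Hbs (ℋ d (a ℕ.+ b ∸ i ∷ [])))) ⟩
        ∑ inner (λ i → (intK (Δ′ i) * (T i * ℋ d (a ℕ.+ b ∸ i ∷ []))) * (Has * Hbs)) ≈⟨ ∑-*ʳ inner _ _ ⟩
        SΔ * (Has * Hbs) ∎

  productFormula : ∀ d → d ≤ d₀ → ProductFormula d
  productFormula = induction-below d₀ ProductFormula product-0 product-suc

theorem3p10 : ∀ {c₁ ℓ₁ c₂ ℓ₂ : Level} (S : Setting c₁ ℓ₁ c₂ ℓ₂) →
    let open Setting S in
    (d : ℕ) → 1 ≤ d → d ≤ d₀ →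
    (rs ss : Word) → All (1 ≤_) rs → All (1 ≤_) ss →
    ℋ̂ d (rs ∗[ r ] ss) K.≈ (ℋ d rs K.* ℋ d ss)
theorem3p10 S d _ d≤d₀ rs ss rs>0 ss>0 =
  ProductFormula.productFormula S d d≤d₀ (length rs ℕ.+ length ss) rs ss rs>0 ss>0 ℕP.≤-refl
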